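{- Consider the following problem parameterized by $r$ and $k$: given a graph $G$, a vertex subset $S\subseteq V(G)$ and a vertex $u\in S$, determine whether $\mathrm{bconn}_r(S,u)<k$. This problem can be solved by a family $(A_{n,r,k})_{n,r,k\in\mathbb{N}}$ of $\mathsf{AC}$-circuits, where $A_{n,r,k}$ handles $n$-vertex graphs, has depth $\mathcal{O}(\log r)$ and size $f(r,k)\cdot n^{\mathcal{O}(1)}$ for some computable function $f$.
   Context: $\mathrm{bconn}_r(S,u)$ is the maximum size of a family of paths in $G$, each of length at most $r$, starting at $u$, ending at a vertex of $S$ different from $u$, with all internal vertices outside $S$, and pairwise sharing only the vertex $u$. Graphs are given as adjacency matrices, vertex subsets as characteristic vectors. $\mathsf{AC}$-circuits have unbounded fan-in AND/OR and NOT gates. -}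

module Defs where

open import Data.Nat using (ℕ; zero; suc; _+_; _*_; _^_; _≤_; _<_; _⊔_)
open import Data.Bool using (Bool; true; false)
open import Data.Fin using (Fin; zero; suc; _≟_)
open import Data.List using (List; []; _∷_; _++_; [_]; length; map; foldr)
open import Data.Bool.ListAction using (and; or)
open import Data.List.Membership.Propositional using (_∈_)
open import Data.List.Relation.Unary.All using (All)
open import Data.List.Relation.Unary.AllPairs using (AllPairs)
open import Data.List.Relation.Unary.Linked using (Linked)
open import Data.List.Relation.Unary.Unique.Propositional using (Unique)
open import Data.Product using (_×_; _,_)
open import Data.Sum using (_⊎_; inj₁; inj₂)
open import Data.Empty using (⊥)
open import Relation.Binary.PropositionalEquality using (_≡_)
open import Relation.Nullary.Decidable using (⌊_⌋)

record Graph (n : ℕ) : Set where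
  field
    adj   : Fin n → Fin n → Bool
    sym   : ∀ i j → adj i j ≡ adj j i
    irrefl : ∀ i → adj i i ≡ false

open Graph public

-- The path is  u , inner , end  (a simple
-- path: all its vertices are pairwise distinct); its length (number of
-- edges) is  suc (length inner).
record BPath {n : ℕ} (r : ℕ) (G : Graph n) (S : Fin n → Bool) (u : Fin n) : Set where
  field
    inner    : List (Fin n)
    end      : Fin n
    walk     : Linked (λ a b → adj G a b ≡ true) (u ∷ (inner ++ [ end ]))
    simple   : Unique (u ∷ (inner ++ [ end ]))
    short    : suc (length inner) ≤ r
    endInS   : S end ≡ true
    innerOut : All (λ v → S v ≡ false) inner

open BPath public

-- vertices of the path other than u (the end vertex differs from u by `simple`)
nonRoot : ∀ {n r G S u} → BPath {n} r G S u → List (Fin n)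
nonRoot p = inner p ++ [ end p ]

Disjoint : ∀ {n} → List (Fin n) → List (Fin n) → Set
Disjoint xs ys = ∀ v → v ∈ xs → v ∈ ys → ⊥

IsFamily : ∀ {n r G S u} → List (BPath {n} r G S u) → Set
IsFamily ps = AllPairs (λ p q → Disjoint (nonRoot p) (nonRoot q)) ps

BconnLt : ∀ {n} → ℕ → Graph n → (Fin n → Bool) → Fin n → ℕ → Set
BconnLt r G S u k = ∀ (ps : List (BPath r G S u)) → IsFamily ps → length ps < k

-- AC circuits (unbounded fan-in AND/OR, NOT) over input variables I.
-- A circuit with w gates: each gate reads inputs or previously built gates.
-- Wire `zero` is the most recently added gate.

Wire : Set → ℕ → Set
Wire I w = I ⊎ Fin w

data Gate (I : Set) (w : ℕ) : Set where
  AND : List (Wire I w) → Gate I w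
  OR  : List (Wire I w) → Gate I w
  NOT : Wire I w → Gate I w

data Gates (I : Set) : ℕ → Set where
  []  : Gates I 0
  _▷_ : ∀ {w} → Gates I w → Gate I w → Gates I (suc w)

cons : ∀ {A : Set} {w} → A → (Fin w → A) → Fin (suc w) → A
cons a f zero    = a
cons a f (suc j) = f j

gateVals : ∀ {I w} → Gates I w → (I → Bool) → Fin w → Bool
gateVals []      x ()
gateVals (c ▷ g) x = cons (evalGate g) (gateVals c x)
  where
  val : _ → Bool
  val (inj₁ i) = x i
  val (inj₂ j) = gateVals c x j
  evalGate : Gate _ _ → Bool
  evalGate (AND ws) = and (map val ws)
  evalGate (OR ws)  = or  (map val ws)
  evalGate (NOT v)  = Data.Bool.not (val v)

maxList : List ℕ → ℕ
maxList = foldr _⊔_ 0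

gateDepths : ∀ {I w} → Gates I w → Fin w → ℕ
gateDepths []      ()
gateDepths (c ▷ g) = cons (suc (dg g)) (gateDepths c)
  where
  d : _ → ℕ
  d (inj₁ i) = 0
  d (inj₂ j) = gateDepths c j
  dg : Gate _ _ → ℕ
  dg (AND ws) = maxList (map d ws)
  dg (OR ws)  = maxList (map d ws)
  dg (NOT v)  = d v

record Circuit (I : Set) : Set where
  field
    nGates : ℕ
    gates  : Gates I nGates
    output : Wire I nGates

open Circuit public

size : ∀ {I} → Circuit I → ℕ
size C = nGates C

depth : ∀ {I} → Circuit I → ℕ
depth C with output C
... | inj₁ i = 0
... | inj₂ j = gateDepths (gates C) j

eval : ∀ {I} → Circuit I → (I → Bool) → Bool
eval C x with output C
... | inj₁ i = x i
... | inj₂ j = gateVals (gates C) x j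

-- Input encoding of an instance (G, S, u) with n vertices:
-- adjacency matrix bits, characteristic vector of S, one-hot vector of u.

Input : ℕ → Set
Input n = (Fin n × Fin n) ⊎ (Fin n ⊎ Fin n)

encode : ∀ {n} → Graph n → (Fin n → Bool) → Fin n → Input n → Bool
encode G S u (inj₁ (i , j))   = adj G i j
encode G S u (inj₂ (inj₁ v)) = S v
encode G S u (inj₂ (inj₂ v)) = ⌊ v ≟ u ⌋

-- Colour coding with a deterministic hash family. Selecting t = (k r + 1)² of the ⌊log₂ n⌋ + 1
-- bits of a vertex number gives colourings Fin n → {0,1}^t; there are at most t^t · 2 (n + 1) of them,
-- and every set of at most k r + 1 vertices is coloured injectively by one of them.  For a fixed
-- colouring, a colourful walk with colours in a set C is found by repeated squaring: a walk with fewer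
-- than 2^(j+1) inner vertices splits at a middle vertex into two walks with fewer than 2^j inner vertices
-- and disjoint colour sets, so ⌈log₂ r⌉ + O(1) levels suffice.  Then bconn_r(S,u) ≥ k iff for some
-- colouring there are k pairwise disjoint colour sets of size at most r, each carrying a colourful path
-- from u into S: disjoint colour sets make the paths internally disjoint, and a colour set of size at
-- most r bounds the length by r.  All index sets have size f(r,k) · (n + 1)^O(1).
module Submission where

open import Defs hiding (sym)
open import Data.Nat using (ℕ; zero; suc; pred; _+_; _*_; _^_; _≤_; _<_; z≤n; s≤s; _≤?_; _<?_; ⌊_/2⌋; ⌈_/2⌉; NonZero; _/_; _%_; >-nonZero)
open import Data.Nat.Properties
open import Data.Nat.DivMod using (m≡m%n+[m/n]*n; m%n<n)
open import Data.Nat.Logarithm using (⌊log₂_⌋; ⌈log₂_⌉)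
open import Data.Nat.Logarithm.Core using (⌊log2⌋; ⌈log2⌉)
open import Data.Nat.Tactic.RingSolver using (solve-∀)
open import Induction.WellFounded using (Acc; acc)
open import Data.Bool using (Bool; true; false; not; T)
open import Data.Bool.ListAction using (and; or)
open import Data.Bool.Properties using (T-≡; T-not-≡)
import Data.Bool.Properties as Bool
open import Data.Fin using (Fin; zero; suc; toℕ; _↑ˡ_; _↑ʳ_)
import Data.Fin.Properties as Fin
open import Data.Vec using (Vec; toList; padRight)
import Data.Vec as Vec
import Data.Vec.Properties as Vec
open import Data.Vec.Membership.Propositional using () renaming (_∈_ to _∈ᵥ_)
open import Data.Vec.Membership.Propositional.Properties using (∈-fromList⁺)
import Data.Vec.Relation.Unary.Any as Anyᵥ
open import Data.Maybe using (Maybe; nothing; just)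
open import Data.Unit using (⊤; tt)
open import Data.Empty using (⊥; ⊥-elim)
open import Data.Product using (Σ; ∃; _×_; _,_; proj₁; proj₂; map₁)
open import Data.Sum using (_⊎_; inj₁; inj₂; [_,_]′; map₂)
import Data.Sum as Sum
open import Data.List using (List; []; _∷_; _++_; [_]; length; map; concat; foldr; take; allFin; cartesianProduct; cartesianProductWith; initLast; _∷ʳ′_)
open import Data.List.Properties using (map-cong; map-∘; foldr-preservesᵇ; ++-assoc; ++-identityʳ; length-++; length-++-sucʳ; length-map; length-tabulate; length-take)
open import Data.List.Membership.Propositional using (_∈_; lose; find)
open import Data.List.Membership.Propositional.Properties using (∈-allFin; ∈-map⁺; ∈-map⁻; ∈-++⁺ʳ; ∈-cartesianProduct⁺; ∈-cartesianProductWith⁺)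
open import Data.List.Relation.Unary.Any using (Any; here; there; index)
import Data.List.Relation.Unary.Any as Any
import Data.List.Relation.Unary.Any.Properties as Any
open import Data.List.Relation.Unary.All using (All; []; _∷_; all?)
import Data.List.Relation.Unary.All as All
import Data.List.Relation.Unary.All.Properties as All
open import Data.List.Relation.Unary.AllPairs using (AllPairs; []; _∷_; allPairs?)
import Data.List.Relation.Unary.AllPairs as AllPairs
import Data.List.Relation.Unary.AllPairs.Properties as AllPairs
open import Data.List.Relation.Unary.Linked using (Linked; [-]; _∷_)
open import Data.List.Relation.Unary.Unique.Propositional using (Unique)
open import Function using (id; _∘_; _∘′_; _on_; case_of_; _⇔_; mk⇔; Equivalence)
open import Relation.Nullary using (Dec; yes; no; ¬_; ¬?)
open import Relation.Nullary.Decidable using (map′; _×-dec_; toWitness; fromWitness)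
open import Relation.Binary.PropositionalEquality hiding ([_]; J)

open Equivalence using (to; from)

-- The constructors of Vec are opened only locally: with them in scope, elaborating the overloaded
-- [] and _∷_ further down becomes prohibitively expensive.
module LayeredCircuits where

  open import Data.Vec using ([]; _∷_)

  module _ {I : Set} {w : ℕ} (c : Gates I w) where

    wireValue : (I → Bool) → Wire I w → Bool
    wireValue x (inj₁ i) = x i
    wireValue x (inj₂ j) = gateVals c x j

    gateValue : (I → Bool) → Gate I w → Bool
    gateValue x (AND ws) = and (map (wireValue x) ws)
    gateValue x (OR ws)  = or (map (wireValue x) ws)
    gateValue x (NOT v)  = not (wireValue x v)

    wireDepth : Wire I w → ℕ
    wireDepth (inj₁ i) = 0
    wireDepth (inj₂ j) = gateDepths c j

    gateDepth : Gate I w → ℕ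
    gateDepth (AND ws) = suc (maxList (map wireDepth ws))
    gateDepth (OR ws)  = suc (maxList (map wireDepth ws))
    gateDepth (NOT v)  = suc (wireDepth v)

    gateVals-▷ : ∀ x g → gateVals (c ▷ g) x zero ≡ gateValue x g
    gateVals-▷ x (AND ws) = cong and (map-cong (λ { (inj₁ _) → refl ; (inj₂ _) → refl }) ws)
    gateVals-▷ x (OR ws)  = cong or (map-cong (λ { (inj₁ _) → refl ; (inj₂ _) → refl }) ws)
    gateVals-▷ x (NOT (inj₁ _)) = refl
    gateVals-▷ x (NOT (inj₂ _)) = refl

    gateDepths-▷ : ∀ g → gateDepths (c ▷ g) zero ≡ gateDepth g
    gateDepths-▷ (AND ws) = cong (λ ds → suc (maxList ds)) (map-cong (λ { (inj₁ _) → refl ; (inj₂ _) → refl }) ws)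
    gateDepths-▷ (OR ws)  = cong (λ ds → suc (maxList ds)) (map-cong (λ { (inj₁ _) → refl ; (inj₂ _) → refl }) ws)
    gateDepths-▷ (NOT (inj₁ _)) = refl
    gateDepths-▷ (NOT (inj₂ _)) = refl

  -- A gate whose inputs are circuit inputs (I) or outputs of the previous layer (J).
  data GateSpec (I J : Set) : Set where
    AND′ OR′ : List (I ⊎ J) → GateSpec I J
    NOT′     : I ⊎ J → GateSpec I J

  evalSpec : ∀ {I J : Set} → (I → Bool) → (J → Bool) → GateSpec I J → Bool
  evalSpec x y (AND′ ss) = and (map [ x , y ]′ ss)
  evalSpec x y (OR′ ss)  = or (map [ x , y ]′ ss)
  evalSpec x y (NOT′ s)  = not ([ x , y ]′ s)

  record Layered (I J : Set) : Set where
    field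
      width : ℕ
      gates : Gates I width
      out   : J → Wire I width

  open Layered public

  value : ∀ {I J} → Layered I J → (I → Bool) → J → Bool
  value L x j = wireValue (gates L) x (out L j)

  depthOf : ∀ {I J} → Layered I J → J → ℕ
  depthOf L j = wireDepth (gates L) (out L j)

  record Enumeration (K : Set) : Set where
    field
      elements : List K
      complete : ∀ k → k ∈ elements

  open Enumeration public

  module _ {I J K : Set} {w : ℕ} (f : K → GateSpec I J) (o : J → Wire I w) (c : Gates I w) where

    private
      source : ∀ m → I ⊎ J → Wire I (m + w)
      source m = [ inj₁ , (λ j → map₂ (m ↑ʳ_) (o j)) ]′

      instantiate : ∀ m → GateSpec I J → Gate I (m + w)
      instantiate m (AND′ ss) = AND (map (source m) ss)
      instantiate m (OR′ ss)  = OR (map (source m) ss)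
      instantiate m (NOT′ s)  = NOT (source m s)

    appendGates : (ks : List K) → Gates I (length ks + w)
    appendGates []       = c
    appendGates (k ∷ ks) = appendGates ks ▷ instantiate (length ks) (f k)

    private
      appendGates-old : ∀ ks x g → gateVals (appendGates ks) x (length ks ↑ʳ g) ≡ gateVals c x g
      appendGates-old []       x g = refl
      appendGates-old (_ ∷ ks) x g = appendGates-old ks x g

      appendGates-oldDepth : ∀ ks g → gateDepths (appendGates ks) (length ks ↑ʳ g) ≡ gateDepths c g
      appendGates-oldDepth []       g = refl
      appendGates-oldDepth (_ ∷ ks) g = appendGates-oldDepth ks g

      source-value : ∀ ks x s → wireValue (appendGates ks) x (source (length ks) s) ≡ [ x , wireValue c x ∘′ o ]′ s
      source-value ks x (inj₁ i) = refl
      source-value ks x (inj₂ j) with o j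
      ... | inj₁ i = refl
      ... | inj₂ g = appendGates-old ks x g

      source-depth : ∀ ks s → wireDepth (appendGates ks) (source (length ks) s) ≡ [ (λ _ → 0) , wireDepth c ∘′ o ]′ s
      source-depth ks (inj₁ i) = refl
      source-depth ks (inj₂ j) with o j
      ... | inj₁ i = refl
      ... | inj₂ g = appendGates-oldDepth ks g

      instantiate-value : ∀ ks x s →
        gateValue (appendGates ks) x (instantiate (length ks) s) ≡ evalSpec x (wireValue c x ∘′ o) s
      instantiate-value ks x (AND′ ss) = cong and (trans (sym (map-∘ ss)) (map-cong (source-value ks x) ss))
      instantiate-value ks x (OR′ ss)  = cong or (trans (sym (map-∘ ss)) (map-cong (source-value ks x) ss))
      instantiate-value ks x (NOT′ s)  = cong not (source-value ks x s)

      maxList-source≤ : ∀ ks D → (∀ j → wireDepth c (o j) ≤ D) → ∀ ss →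
        maxList (map (wireDepth (appendGates ks)) (map (source (length ks)) ss)) ≤ D
      maxList-source≤ ks D h ss = foldr-preservesᵇ ⊔-lub z≤n
        (subst (All (_≤ D)) (map-∘ ss) (All.map⁺ (All.tabulate (λ {s} _ → source-depth≤ s))))
        where
        source-depth≤ : ∀ s → wireDepth (appendGates ks) (source (length ks) s) ≤ D
        source-depth≤ (inj₁ i) = z≤n
        source-depth≤ (inj₂ j) = subst (_≤ D) (sym (source-depth ks (inj₂ j))) (h j)

      instantiate-depth : ∀ ks D → (∀ j → wireDepth c (o j) ≤ D) → ∀ s →
        gateDepth (appendGates ks) (instantiate (length ks) s) ≤ suc D
      instantiate-depth ks D h (AND′ ss) = s≤s (maxList-source≤ ks D h ss)
      instantiate-depth ks D h (OR′ ss)  = s≤s (maxList-source≤ ks D h ss)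
      instantiate-depth ks D h (NOT′ (inj₁ i)) = s≤s z≤n
      instantiate-depth ks D h (NOT′ (inj₂ j)) = s≤s (subst (_≤ D) (sym (source-depth ks (inj₂ j))) (h j))

    appendGates-new : ∀ ks x {k} (p : k ∈ ks) →
      gateVals (appendGates ks) x (index p ↑ˡ w) ≡ evalSpec x (wireValue c x ∘′ o) (f k)
    appendGates-new (k ∷ ks) x (here refl) =
      trans (gateVals-▷ (appendGates ks) x (instantiate (length ks) (f k))) (instantiate-value ks x (f k))
    appendGates-new (_ ∷ ks) x (there p) = appendGates-new ks x p

    appendGates-newDepth : ∀ ks D → (∀ j → wireDepth c (o j) ≤ D) → ∀ {k} (p : k ∈ ks) →
      gateDepths (appendGates ks) (index p ↑ˡ w) ≤ suc D
    appendGates-newDepth (k ∷ ks) D h (here refl) =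
      subst (_≤ suc D) (sym (gateDepths-▷ (appendGates ks) (instantiate (length ks) (f k))))
            (instantiate-depth ks D h (f k))
    appendGates-newDepth (_ ∷ ks) D h (there p) = appendGates-newDepth ks D h p

  noGates : ∀ {I} → Layered I ⊥
  noGates = record { width = 0 ; gates = [] ; out = λ () }

  extend : ∀ {I J K : Set} → Layered I J → Enumeration K → (K → GateSpec I J) → Layered I K
  extend L E f = record
    { width = length (elements E) + width L
    ; gates = appendGates f (out L) (gates L) (elements E)
    ; out   = λ k → inj₂ (index (complete E k) ↑ˡ width L)
    }

  extend-value : ∀ {I J K : Set} (L : Layered I J) (E : Enumeration K) f x k →
                 value (extend L E f) x k ≡ evalSpec x (value L x) (f k)
  extend-value L E f x k = appendGates-new f (out L) (gates L) (elements E) x (complete E k)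

  extend-depth : ∀ {I J K : Set} (L : Layered I J) (E : Enumeration K) f D →
                 (∀ j → depthOf L j ≤ D) → ∀ k → depthOf (extend L E f) k ≤ suc D
  extend-depth L E f D h k = appendGates-newDepth f (out L) (gates L) (elements E) D h (complete E k)

  guard : ∀ {I J P : Set} → Dec P → GateSpec I J → GateSpec I J
  guard (yes _) g = g
  guard (no _)  g = OR′ []

  anyOf : ∀ {I J O : Set} → Enumeration O → (O → J) → GateSpec I J
  anyOf E h = OR′ (map (inj₂ ∘′ h) (elements E))

  allOf : ∀ {I J O : Set} → List O → (O → J) → GateSpec I J
  allOf os h = AND′ (map (inj₂ ∘′ h) os)

  module _ {I J : Set} (x : I → Bool) (y : J → Bool) where

    AND′⁻ : ∀ ss → T (evalSpec x y (AND′ ss)) → All (T ∘′ [ x , y ]′) ss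
    AND′⁻ = All.all⁺ _

    AND′⁺ : ∀ ss → All (T ∘′ [ x , y ]′) ss → T (evalSpec x y (AND′ ss))
    AND′⁺ _ = All.all⁻ _

    anyOf⁻ : ∀ {O : Set} (E : Enumeration O) h → T (evalSpec x y (anyOf E h)) → ∃ λ o → T (y (h o))
    anyOf⁻ E h = Any.satisfied ∘′ Any.map⁻ ∘′ Any.any⁻ _ (map (inj₂ ∘′ h) (elements E))

    anyOf⁺ : ∀ {O : Set} (E : Enumeration O) h o → T (y (h o)) → T (evalSpec x y (anyOf E h))
    anyOf⁺ E h o p = Any.any⁺ _ (Any.map⁺ {f = inj₂ ∘′ h} (lose (complete E o) p))

    allOf⁻ : ∀ {O : Set} (os : List O) h → T (evalSpec x y (allOf os h)) → All (λ o → T (y (h o))) os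
    allOf⁻ os h = All.map⁻ ∘′ AND′⁻ (map (inj₂ ∘′ h) os)

    allOf⁺ : ∀ {O : Set} (os : List O) h → All (λ o → T (y (h o))) os → T (evalSpec x y (allOf os h))
    allOf⁺ os h = AND′⁺ (map (inj₂ ∘′ h) os) ∘′ All.map⁺ {f = inj₂ ∘′ h}

  module _ {I J : Set} {x : I → Bool} {y : J → Bool} where

    guard⁻ : ∀ {P : Set} (d : Dec P) {g} → T (evalSpec x y (guard d g)) → P × T (evalSpec x y g)
    guard⁻ (yes p) h = p , h

    guard⁺ : ∀ {P : Set} (d : Dec P) {g} → P → T (evalSpec x y g) → T (evalSpec x y (guard d g))
    guard⁺ (yes _) _ h = h
    guard⁺ (no ¬p) p _ = ⊥-elim (¬p p)

  enumFin : ∀ n → Enumeration (Fin n)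
  enumFin n = record { elements = allFin n ; complete = ∈-allFin }

  infixr 2 _×ₑ_

  _×ₑ_ : ∀ {A B : Set} → Enumeration A → Enumeration B → Enumeration (A × B)
  EA ×ₑ EB = record
    { elements = cartesianProduct (elements EA) (elements EB)
    ; complete = λ (a , b) → ∈-cartesianProduct⁺ (complete EA a) (complete EB b)
    }

  enumMaybe : ∀ {A : Set} → Enumeration A → Enumeration (Maybe A)
  enumMaybe EA = record
    { elements = nothing ∷ map just (elements EA)
    ; complete = λ { nothing → here refl ; (just a) → there (∈-map⁺ just (complete EA a)) }
    }

  enumVec : ∀ {A : Set} → Enumeration A → ∀ k → Enumeration (Vec A k)
  enumVec EA zero    = record { elements = [] ∷ [] ; complete = λ { [] → here refl } }
  enumVec EA (suc k) = record
    { elements = cartesianProductWith _∷_ (elements EA) (elements (enumVec EA k))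
    ; complete = λ { (a ∷ as) → ∈-cartesianProductWith⁺ _∷_ (complete EA a) (complete (enumVec EA k) as) }
    }

  enum⊤ : Enumeration ⊤
  enum⊤ = record { elements = tt ∷ [] ; complete = λ _ → here refl }

  length-cartesianProductWith : ∀ {A B C : Set} (f : A → B → C) xs ys →
                                length (cartesianProductWith f xs ys) ≡ length xs * length ys
  length-cartesianProductWith f []       ys = refl
  length-cartesianProductWith f (x ∷ xs) ys = begin
    length (map (f x) ys ++ cartesianProductWith f xs ys)        ≡⟨ length-++ (map (f x) ys) ⟩
    length (map (f x) ys) + length (cartesianProductWith f xs ys) ≡⟨ cong₂ _+_ (length-map (f x) ys)
                                                                       (length-cartesianProductWith f xs ys) ⟩
    length ys + length xs * length ys                             ∎
    where open ≡-Reasoning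

  -- value is not injective, so L, E and f cannot be inferred from the type of a firing gate.
  module _ {I J K : Set} (L : Layered I J) (E : Enumeration K) (f : K → GateSpec I J) {x : I → Bool} where

    extend⁻ : ∀ {k} → T (value (extend L E f) x k) → T (evalSpec x (value L x) (f k))
    extend⁻ {k} = subst T (extend-value L E f x k)

    extend⁺ : ∀ {k} → T (evalSpec x (value L x) (f k)) → T (value (extend L E f) x k)
    extend⁺ {k} = subst T (sym (extend-value L E f x k))

  ∣_∣ₑ : ∀ {A : Set} → Enumeration A → ℕ
  ∣ E ∣ₑ = length (elements E)

  ∣enumFin∣ : ∀ n → ∣ enumFin n ∣ₑ ≡ n
  ∣enumFin∣ n = length-tabulate id

  ∣×ₑ∣ : ∀ {A B : Set} (EA : Enumeration A) (EB : Enumeration B) → ∣ EA ×ₑ EB ∣ₑ ≡ ∣ EA ∣ₑ * ∣ EB ∣ₑ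
  ∣×ₑ∣ EA EB = length-cartesianProductWith _,_ (elements EA) (elements EB)

  ∣enumMaybe∣ : ∀ {A : Set} (EA : Enumeration A) → ∣ enumMaybe EA ∣ₑ ≡ suc ∣ EA ∣ₑ
  ∣enumMaybe∣ EA = cong suc (length-map just (elements EA))

  ∣enumVec∣ : ∀ {A : Set} (EA : Enumeration A) k → ∣ enumVec EA k ∣ₑ ≡ ∣ EA ∣ₑ ^ k
  ∣enumVec∣ EA zero    = refl
  ∣enumVec∣ EA (suc k) = trans (length-cartesianProductWith _∷_ (elements EA) (elements (enumVec EA k)))
                               (cong (∣ EA ∣ₑ *_) (∣enumVec∣ EA k))

open LayeredCircuits

module BitSets where

  open import Data.Vec using ([]; _∷_)

  -- A subset of {0,1}^t, tabulated as a complete binary tree of depth t.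
  data BitSet : ℕ → Set where
    leaf : Bool → BitSet zero
    node : ∀ {t} → BitSet t → BitSet t → BitSet (suc t)

  infix 4 _∈ₛ_

  data _∈ₛ_ : ∀ {t} → Vec Bool t → BitSet t → Set where
    at-leaf  : [] ∈ₛ leaf true
    left  : ∀ {t v} {A B : BitSet t} → v ∈ₛ A → false ∷ v ∈ₛ node A B
    right : ∀ {t v} {A B : BitSet t} → v ∈ₛ B → true ∷ v ∈ₛ node A B

  module _ {t : ℕ} where

    infix 4 _⊆ₛ_

    _⊆ₛ_ : BitSet t → BitSet t → Set
    A ⊆ₛ B = ∀ {v} → v ∈ₛ A → v ∈ₛ B

    Disjointₛ : BitSet t → BitSet t → Set
    Disjointₛ A B = ∀ {v} → v ∈ₛ A → v ∈ₛ B → ⊥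

  _∈ₛ?_ : ∀ {t} v (A : BitSet t) → Dec (v ∈ₛ A)
  []          ∈ₛ? leaf true  = yes at-leaf
  []          ∈ₛ? leaf false = no λ ()
  (false ∷ v) ∈ₛ? node A B   = map′ left (λ { (left p) → p }) (v ∈ₛ? A)
  (true ∷ v)  ∈ₛ? node A B   = map′ right (λ { (right p) → p }) (v ∈ₛ? B)

  ∅ₛ : ∀ t → BitSet t
  ∅ₛ zero    = leaf false
  ∅ₛ (suc t) = node (∅ₛ t) (∅ₛ t)

  insert : ∀ {t} → Vec Bool t → BitSet t → BitSet t
  insert []          (leaf _)   = leaf true
  insert (false ∷ v) (node A B) = node (insert v A) B
  insert (true ∷ v)  (node A B) = node A (insert v B)

  fromList : ∀ {t} → List (Vec Bool t) → BitSet t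
  fromList {t} = foldr insert (∅ₛ t)

  ∣_∣ₛ : ∀ {t} → BitSet t → ℕ
  ∣ leaf false ∣ₛ = 0
  ∣ leaf true ∣ₛ  = 1
  ∣ node A B ∣ₛ   = ∣ A ∣ₛ + ∣ B ∣ₛ

  _⊆ₛ?_ : ∀ {t} (A B : BitSet t) → Dec (A ⊆ₛ B)
  leaf false ⊆ₛ? B          = yes λ ()
  leaf true  ⊆ₛ? leaf true  = yes λ p → p
  leaf true  ⊆ₛ? leaf false = no λ A⊆B → case A⊆B at-leaf of λ ()
  node A B   ⊆ₛ? node A′ B′ = map′ join split ((A ⊆ₛ? A′) ×-dec (B ⊆ₛ? B′))
    where
    join : A ⊆ₛ A′ × B ⊆ₛ B′ → node A B ⊆ₛ node A′ B′
    join (l , r) (left p)  = left (l p)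
    join (l , r) (right p) = right (r p)
    split : node A B ⊆ₛ node A′ B′ → A ⊆ₛ A′ × B ⊆ₛ B′
    split h = (λ p → case h (left p) of λ { (left q) → q }) , (λ p → case h (right p) of λ { (right q) → q })

  disjointₛ? : ∀ {t} (A B : BitSet t) → Dec (Disjointₛ A B)
  disjointₛ? (leaf false) B            = yes λ ()
  disjointₛ? (leaf true)  (leaf false) = yes λ _ ()
  disjointₛ? (leaf true)  (leaf true)  = no λ A#B → A#B at-leaf at-leaf
  disjointₛ? (node A B)   (node A′ B′) = map′ join split (disjointₛ? A A′ ×-dec disjointₛ? B B′)
    where
    join : Disjointₛ A A′ × Disjointₛ B B′ → Disjointₛ (node A B) (node A′ B′)
    join (l , r) (left p)  (left q)  = l p q
    join (l , r) (right p) (right q) = r p q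
    split : Disjointₛ (node A B) (node A′ B′) → Disjointₛ A A′ × Disjointₛ B B′
    split h = (λ p q → h (left p) (left q)) , (λ p q → h (right p) (right q))

  ∉ₛ-∅ₛ : ∀ {t} {v : Vec Bool t} → ¬ v ∈ₛ ∅ₛ t
  ∉ₛ-∅ₛ {suc t} (left p)  = ∉ₛ-∅ₛ p
  ∉ₛ-∅ₛ {suc t} (right p) = ∉ₛ-∅ₛ p

  ∈ₛ-insert-self : ∀ {t} v (A : BitSet t) → v ∈ₛ insert v A
  ∈ₛ-insert-self []          (leaf _)   = at-leaf
  ∈ₛ-insert-self (false ∷ v) (node A B) = left (∈ₛ-insert-self v A)
  ∈ₛ-insert-self (true ∷ v)  (node A B) = right (∈ₛ-insert-self v B)

  ∈ₛ-insert⁺ : ∀ {t} v (A : BitSet t) {w} → w ∈ₛ A → w ∈ₛ insert v A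
  ∈ₛ-insert⁺ []          (leaf _)   at-leaf      = at-leaf
  ∈ₛ-insert⁺ (false ∷ v) (node A B) (left p)  = left (∈ₛ-insert⁺ v A p)
  ∈ₛ-insert⁺ (false ∷ v) (node A B) (right p) = right p
  ∈ₛ-insert⁺ (true ∷ v)  (node A B) (left p)  = left p
  ∈ₛ-insert⁺ (true ∷ v)  (node A B) (right p) = right (∈ₛ-insert⁺ v B p)

  ∈ₛ-insert⁻ : ∀ {t} v (A : BitSet t) {w} → w ∈ₛ insert v A → w ≡ v ⊎ w ∈ₛ A
  ∈ₛ-insert⁻ []          (leaf _)   at-leaf      = inj₁ refl
  ∈ₛ-insert⁻ (false ∷ v) (node A B) (left p)  = Sum.map (cong (false ∷_)) left (∈ₛ-insert⁻ v A p)
  ∈ₛ-insert⁻ (false ∷ v) (node A B) (right p) = inj₂ (right p)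
  ∈ₛ-insert⁻ (true ∷ v)  (node A B) (left p)  = inj₂ (left p)
  ∈ₛ-insert⁻ (true ∷ v)  (node A B) (right p) = Sum.map (cong (true ∷_)) right (∈ₛ-insert⁻ v B p)

  ∈ₛ-fromList⁺ : ∀ {t} {v : Vec Bool t} {xs} → v ∈ xs → v ∈ₛ fromList xs
  ∈ₛ-fromList⁺ {xs = x ∷ xs} (here refl) = ∈ₛ-insert-self x (fromList xs)
  ∈ₛ-fromList⁺ {xs = x ∷ xs} (there p)   = ∈ₛ-insert⁺ x (fromList xs) (∈ₛ-fromList⁺ p)

  ∈ₛ-fromList⁻ : ∀ {t} {v : Vec Bool t} xs → v ∈ₛ fromList xs → v ∈ xs
  ∈ₛ-fromList⁻ []       p = ⊥-elim (∉ₛ-∅ₛ p)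
  ∈ₛ-fromList⁻ (x ∷ xs) p = Sum.[ here , there ∘ ∈ₛ-fromList⁻ xs ]′ (∈ₛ-insert⁻ x (fromList xs) p)

  ∣∅ₛ∣ : ∀ t → ∣ ∅ₛ t ∣ₛ ≡ 0
  ∣∅ₛ∣ zero    = refl
  ∣∅ₛ∣ (suc t) = cong₂ _+_ (∣∅ₛ∣ t) (∣∅ₛ∣ t)

  ∣insert∣ : ∀ {t} v (A : BitSet t) → ¬ v ∈ₛ A → ∣ insert v A ∣ₛ ≡ suc ∣ A ∣ₛ
  ∣insert∣ []          (leaf false) v∉A = refl
  ∣insert∣ []          (leaf true)  v∉A = ⊥-elim (v∉A at-leaf)
  ∣insert∣ (false ∷ v) (node A B)   v∉A = cong (_+ ∣ B ∣ₛ) (∣insert∣ v A (v∉A ∘ left))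
  ∣insert∣ (true ∷ v)  (node A B)   v∉A =
    trans (cong (∣ A ∣ₛ +_) (∣insert∣ v B (v∉A ∘ right))) (+-suc ∣ A ∣ₛ ∣ B ∣ₛ)

  ∣fromList∣ : ∀ {t} {xs : List (Vec Bool t)} → Unique xs → ∣ fromList xs ∣ₛ ≡ length xs
  ∣fromList∣ {t} {[]}      []         = ∣∅ₛ∣ t
  ∣fromList∣ {xs = x ∷ xs} (x∉xs ∷ u) =
    trans (∣insert∣ x (fromList xs) (λ x∈ → All.lookup x∉xs (∈ₛ-fromList⁻ xs x∈) refl))
          (cong suc (∣fromList∣ u))

  ∣∣-mono-⊆ₛ : ∀ {t} {A B : BitSet t} → A ⊆ₛ B → ∣ A ∣ₛ ≤ ∣ B ∣ₛ
  ∣∣-mono-⊆ₛ {A = leaf false} {_}          A⊆B = z≤n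
  ∣∣-mono-⊆ₛ {A = leaf true}  {leaf true}  A⊆B = ≤-refl
  ∣∣-mono-⊆ₛ {A = leaf true}  {leaf false} A⊆B = case A⊆B at-leaf of λ ()
  ∣∣-mono-⊆ₛ {A = node A B}   {node A′ B′} A⊆B =
    +-mono-≤ (∣∣-mono-⊆ₛ λ p → case A⊆B (left p) of λ { (left q) → q })
             (∣∣-mono-⊆ₛ λ p → case A⊆B (right p) of λ { (right q) → q })

  length≤∣∣ₛ : ∀ {t} {xs : List (Vec Bool t)} {A} → Unique xs → All (_∈ₛ A) xs → length xs ≤ ∣ A ∣ₛ
  length≤∣∣ₛ {xs = xs} {A} u xs⊆A =
    subst (_≤ ∣ A ∣ₛ) (∣fromList∣ u) (∣∣-mono-⊆ₛ (All.lookup xs⊆A ∘ ∈ₛ-fromList⁻ xs))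

open BitSets

module BitSelection where

  open import Data.Vec using ([]; _∷_)

  n≤2*⌈n/2⌉ : ∀ n → n ≤ 2 * ⌈ n /2⌉
  n≤2*⌈n/2⌉ n = begin
    n                 ≡⟨ sym (⌊n/2⌋+⌈n/2⌉≡n n) ⟩
    ⌊ n /2⌋ + ⌈ n /2⌉ ≤⟨ +-monoˡ-≤ ⌈ n /2⌉ (⌊n/2⌋≤⌈n/2⌉ n) ⟩
    ⌈ n /2⌉ + ⌈ n /2⌉ ≡⟨ cong (⌈ n /2⌉ +_) (sym (+-identityʳ _)) ⟩
    2 * ⌈ n /2⌉       ∎
    where open ≤-Reasoning

  n≤2^⌈log₂n⌉ : ∀ n → n ≤ 2 ^ ⌈log₂ n ⌉
  n≤2^⌈log₂n⌉ n = go n _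
    where
    go : ∀ n (rec : Acc _<_ n) → n ≤ 2 ^ ⌈log2⌉ n rec
    go zero          _        = z≤n
    go (suc zero)    _        = s≤s z≤n
    go (suc (suc n)) (acc rs) = begin
      2 + n                ≤⟨ s≤s (s≤s (n≤2*⌈n/2⌉ n)) ⟩
      2 + 2 * ⌈ n /2⌉      ≡⟨ sym (*-distribˡ-+ 2 1 ⌈ n /2⌉) ⟩
      2 * suc ⌈ n /2⌉      ≤⟨ *-monoʳ-≤ 2 (go (suc ⌈ n /2⌉) _) ⟩
      2 * 2 ^ ⌈log2⌉ (suc ⌈ n /2⌉) _ ∎
      where open ≤-Reasoning

  odd : ℕ → Bool
  odd zero          = false
  odd (suc zero)    = true
  odd (suc (suc n)) = odd n

  testBit : ℕ → ℕ → Bool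
  testBit x zero    = odd x
  testBit x (suc q) = testBit ⌊ x /2⌋ q

  digit : Bool → ℕ
  digit false = 0
  digit true  = 1

  n≡digit+2*⌊n/2⌋ : ∀ n → n ≡ digit (odd n) + 2 * ⌊ n /2⌋
  n≡digit+2*⌊n/2⌋ zero          = refl
  n≡digit+2*⌊n/2⌋ (suc zero)    = refl
  n≡digit+2*⌊n/2⌋ (suc (suc n)) = begin
    2 + n                                  ≡⟨ cong (2 +_) (n≡digit+2*⌊n/2⌋ n) ⟩
    2 + (digit (odd n) + 2 * ⌊ n /2⌋)      ≡⟨ cong suc (sym (+-suc (digit (odd n)) _)) ⟩
    1 + (digit (odd n) + (1 + 2 * ⌊ n /2⌋)) ≡⟨ sym (+-suc (digit (odd n)) _) ⟩
    digit (odd n) + (2 + 2 * ⌊ n /2⌋)      ≡⟨ cong (digit (odd n) +_) (sym (*-suc 2 ⌊ n /2⌋)) ⟩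
    digit (odd n) + 2 * suc ⌊ n /2⌋        ∎
    where open ≡-Reasoning

  2*⌊n/2⌋≤n : ∀ n → 2 * ⌊ n /2⌋ ≤ n
  2*⌊n/2⌋≤n n = subst (2 * ⌊ n /2⌋ ≤_) (sym (n≡digit+2*⌊n/2⌋ n)) (m≤n+m _ (digit (odd n)))

  n≤1+2*⌊n/2⌋ : ∀ n → n ≤ 1 + 2 * ⌊ n /2⌋
  n≤1+2*⌊n/2⌋ n = subst (_≤ 1 + 2 * ⌊ n /2⌋) (sym (n≡digit+2*⌊n/2⌋ n))
    (+-monoˡ-≤ (2 * ⌊ n /2⌋) (digit≤1 (odd n)))
    where
    digit≤1 : ∀ b → digit b ≤ 1
    digit≤1 false = z≤n
    digit≤1 true  = s≤s z≤n

  2^⌊log₂n⌋≤n : ∀ n → 2 ^ ⌊log₂ suc n ⌋ ≤ suc n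
  2^⌊log₂n⌋≤n n = go n _
    where
    go : ∀ n (rec : Acc _<_ (suc n)) → 2 ^ ⌊log2⌋ (suc n) rec ≤ suc n
    go zero    _        = s≤s z≤n
    go (suc n) (acc rs) = begin
      2 * 2 ^ ⌊log2⌋ (suc ⌊ n /2⌋) _ ≤⟨ *-monoʳ-≤ 2 (go ⌊ n /2⌋ _) ⟩
      2 * suc ⌊ n /2⌋                ≡⟨ *-suc 2 ⌊ n /2⌋ ⟩
      2 + 2 * ⌊ n /2⌋                ≤⟨ +-monoʳ-≤ 2 (2*⌊n/2⌋≤n n) ⟩
      2 + n                          ∎
      where open ≤-Reasoning

  2^suc⌊log₂n⌋≤2[1+n] : ∀ n → 2 ^ suc ⌊log₂ n ⌋ ≤ 2 * suc n
  2^suc⌊log₂n⌋≤2[1+n] zero    = s≤s (s≤s z≤n)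
  2^suc⌊log₂n⌋≤2[1+n] (suc n) = *-monoʳ-≤ 2 (≤-trans (2^⌊log₂n⌋≤n n) (n≤1+n _))

  n<2^suc⌊log₂n⌋ : ∀ n → n < 2 ^ suc ⌊log₂ n ⌋
  n<2^suc⌊log₂n⌋ n = go n _
    where
    go : ∀ n (rec : Acc _<_ n) → n < 2 ^ suc (⌊log2⌋ n rec)
    go zero          _        = s≤s z≤n
    go (suc zero)    _        = s≤s (s≤s z≤n)
    go (suc (suc n)) (acc rs) = begin-strict
      2 + n                              ≤⟨ +-monoʳ-≤ 2 (n≤1+2*⌊n/2⌋ n) ⟩
      3 + 2 * ⌊ n /2⌋                    <⟨ +-monoˡ-< (2 * ⌊ n /2⌋) (n<1+n 3) ⟩
      4 + 2 * ⌊ n /2⌋                    ≡⟨ sym (*-distribˡ-+ 2 2 ⌊ n /2⌋) ⟩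
      2 * (2 + ⌊ n /2⌋)                  ≤⟨ *-monoʳ-≤ 2 (go (suc ⌊ n /2⌋) _) ⟩
      2 * 2 ^ suc (⌊log2⌋ (suc ⌊ n /2⌋) _) ∎
      where open ≤-Reasoning

  ⌊n/2⌋<2^L : ∀ {n} L → n < 2 ^ suc L → ⌊ n /2⌋ < 2 ^ L
  ⌊n/2⌋<2^L {n} L n<2^1+L = *-cancelˡ-< 2 ⌊ n /2⌋ (2 ^ L) (≤-<-trans (2*⌊n/2⌋≤n n) n<2^1+L)

  testBit-separates : ∀ L {x y} → x < 2 ^ L → y < 2 ^ L → x ≢ y →
                      Σ (Fin L) λ q → testBit x (toℕ q) ≢ testBit y (toℕ q)
  testBit-separates zero    {zero}  {zero}  _         _         x≢y = ⊥-elim (x≢y refl)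
  testBit-separates zero    {suc x} {_}     (s≤s ()) _         _
  testBit-separates zero    {zero}  {suc y} _         (s≤s ()) _
  testBit-separates (suc L) {x}     {y}     x<2^L     y<2^L     x≢y with odd x Bool.≟ odd y
  ... | no odd-x≢odd-y = zero , odd-x≢odd-y
  ... | yes odd-x≡odd-y =
    let q , differ = testBit-separates L (⌊n/2⌋<2^L L x<2^L) (⌊n/2⌋<2^L L y<2^L) halves-differ
    in suc q , differ
    where
    halves-differ : ⌊ x /2⌋ ≢ ⌊ y /2⌋
    halves-differ eq = x≢y (begin
      x                              ≡⟨ n≡digit+2*⌊n/2⌋ x ⟩
      digit (odd x) + 2 * ⌊ x /2⌋    ≡⟨ cong₂ (λ b h → digit b + 2 * h) odd-x≡odd-y eq ⟩
      digit (odd y) + 2 * ⌊ y /2⌋    ≡⟨ sym (n≡digit+2*⌊n/2⌋ y) ⟩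
      y                              ∎)
      where open ≡-Reasoning

  m+m*m≤[1+m]*[1+m] : ∀ m → m + m * m ≤ suc m * suc m
  m+m*m≤[1+m]*[1+m] m = ≤-trans (+-monoʳ-≤ m (*-monoʳ-≤ m (n≤1+n m))) (n≤1+n _)

  witnesses : ∀ {A B : Set} {P : A → B → Set} {xs : List A} → All (λ x → Σ B (P x)) xs →
              Σ (List B) λ ws → length ws ≡ length xs × All (λ x → Any (P x) ws) xs
  witnesses []                = [] , refl , []
  witnesses ((w , pw) ∷ pws) =
    let ws , len , any = witnesses pws
    in w ∷ ws , cong suc len , here pw ∷ All.map there any

  ∈ᵥ-padRight⁺ : ∀ {A : Set} {m t} (m≤t : m ≤ t) (a : A) {x} {xs : Vec A m} → x ∈ᵥ xs → x ∈ᵥ padRight m≤t a xs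
  ∈ᵥ-padRight⁺ (s≤s m≤t) a (Anyᵥ.here refl) = Anyᵥ.here refl
  ∈ᵥ-padRight⁺ (s≤s m≤t) a (Anyᵥ.there x∈) = Anyᵥ.there (∈ᵥ-padRight⁺ m≤t a x∈)

  module _ {n L : ℕ} where

    bit : Fin L → Fin n → Bool
    bit q v = testBit (toℕ v) (toℕ q)

    colouring : ∀ {t} → Vec (Fin L) t → Fin n → Vec Bool t
    colouring P v = Vec.map (λ q → bit q v) P

    colouring-≢ : ∀ {t} {P : Vec (Fin L) t} {q x y} → q ∈ᵥ P → bit q x ≢ bit q y → colouring P x ≢ colouring P y
    colouring-≢ {P = p ∷ P} (Anyᵥ.here refl) differ eq = differ (cong Vec.head eq)
    colouring-≢ {P = p ∷ P} (Anyᵥ.there q∈P) differ eq = colouring-≢ q∈P differ (cong Vec.tail eq)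

    SeparatedBy : List (Fin L) → Fin n → Fin n → Set
    SeparatedBy Q x y = Any (λ q → bit q x ≢ bit q y) Q

    module _ (n≤2^L : n ≤ 2 ^ L) where

      separatingBit : ∀ {x y : Fin n} → x ≢ y → Σ (Fin L) λ q → bit q x ≢ bit q y
      separatingBit {x} {y} x≢y =
        testBit-separates L (<-≤-trans (Fin.toℕ<n x) n≤2^L) (<-≤-trans (Fin.toℕ<n y) n≤2^L)
                            (x≢y ∘ Fin.toℕ-injective)

      separatingBits : ∀ (X : List (Fin n)) → Unique X →
                       Σ (List (Fin L)) λ Q → length Q ≤ length X * length X × AllPairs (SeparatedBy Q) X
      separatingBits []      []         = [] , z≤n , []
      separatingBits (y ∷ X) (y∉X ∷ uX)
        with Q , |Q|≤ , sepQ ← separatingBits X uX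
        with R , |R|≡ , sepR ← witnesses (All.map separatingBit y∉X)
        = R ++ Q ,
          ≤-trans (≤-reflexive (length-++ R))
                  (≤-trans (+-mono-≤ (≤-reflexive |R|≡) |Q|≤) (m+m*m≤[1+m]*[1+m] (length X))) ,
          All.map (Any.++⁺ˡ {ys = Q}) sepR ∷ AllPairs.map (Any.++⁺ʳ R) sepQ

  -- One bit position separating each pair of vertices of X, padded to length t, colours X injectively.
  hashing : ∀ {n ℓ} → n ≤ 2 ^ suc ℓ → ∀ t (X : List (Fin n)) → Unique X → length X * length X ≤ t →
            Σ (Vec (Fin (suc ℓ)) t) λ P → AllPairs (_≢_ on colouring P) X
  hashing n≤2^L t X uX |X|²≤t with Q , |Q|≤ , sepQ ← separatingBits n≤2^L X uX
    = P , AllPairs.map separated sepQ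
    where
    |Q|≤t = ≤-trans |Q|≤ |X|²≤t
    P = padRight |Q|≤t zero (Vec.fromList Q)
    separated : ∀ {x y} → SeparatedBy Q x y → colouring P x ≢ colouring P y
    separated sep with q , q∈Q , differ ← find sep = colouring-≢ (∈ᵥ-padRight⁺ |Q|≤t zero (∈-fromList⁺ q∈Q)) differ

open BitSelection

module _ {A : Set} {R : A → A → Set} where

  Linked-glue : ∀ a xs c ys → Linked R (a ∷ xs ++ [ c ]) → Linked R (c ∷ ys) → Linked R (a ∷ xs ++ c ∷ ys)
  Linked-glue a []       c ys (r ∷ [-]) l = r ∷ l
  Linked-glue a (x ∷ xs) c ys (r ∷ l₁)  l = r ∷ Linked-glue x xs c ys l₁ l

  Linked-cut : ∀ a xs c ys → Linked R (a ∷ xs ++ c ∷ ys) → Linked R (a ∷ xs ++ [ c ]) × Linked R (c ∷ ys)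
  Linked-cut a []       c []       (r ∷ [-]) = r ∷ [-] , [-]
  Linked-cut a []       c (y ∷ ys) (r ∷ l)   = r ∷ [-] , l
  Linked-cut a (x ∷ xs) c ys       (r ∷ l)   = map₁ (r ∷_) (Linked-cut x xs c ys l)

  AllPairs-++⁻ : ∀ xs {ys} → AllPairs R (xs ++ ys) → AllPairs R xs × AllPairs R ys × All (λ x → All (R x) ys) xs
  AllPairs-++⁻ []       p        = [] , p , []
  AllPairs-++⁻ (x ∷ xs) (h ∷ p) =
    let pxs , pys , cross = AllPairs-++⁻ xs p
    in All.++⁻ˡ xs h ∷ pxs , pys , All.++⁻ʳ xs h ∷ cross

  AllPairs-concat⁻ : ∀ {xss : List (List A)} → AllPairs R (concat xss) →
                     All (AllPairs R) xss × AllPairs (λ xs ys → All (λ x → All (R x) ys) xs) xss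
  AllPairs-concat⁻ {[]}       []   = [] , []
  AllPairs-concat⁻ {xs ∷ xss} rxss =
    let rxs , rest , cross = AllPairs-++⁻ xs rxss
        inner , outer = AllPairs-concat⁻ rest
    in rxs ∷ inner , All.All-swap (All.map All.concat⁻ cross) ∷ outer

splitAt : ∀ {A : Set} (xs : List A) {p} → p < length xs →
          Σ (List A) λ ys → Σ A λ c → Σ (List A) λ zs → xs ≡ ys ++ c ∷ zs × length ys ≡ p
splitAt (x ∷ xs) {zero}  _         = [] , x , xs , refl , refl
splitAt (x ∷ xs) {suc p} (s≤s p<n) =
  let ys , c , zs , eq , len = splitAt xs p<n in x ∷ ys , c , zs , cong (x ∷_) eq , cong suc len

++-[]-split : ∀ {A : Set} (xs : List A) c ys b → (xs ++ c ∷ ys) ++ [ b ] ≡ (xs ++ [ c ]) ++ (ys ++ [ b ])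
++-[]-split xs c ys b = trans (++-assoc xs (c ∷ ys) [ b ]) (sym (++-assoc xs [ c ] (ys ++ [ b ])))

length-++-[] : ∀ {A : Set} (xs : List A) y → length (xs ++ [ y ]) ≡ suc (length xs)
length-++-[] xs y = trans (length-++-sucʳ xs y []) (cong (suc ∘ length) (++-identityʳ xs))

not-≡-true : ∀ {b} → not b ≡ true ⇔ (¬ T b)
not-≡-true {false} = mk⇔ (λ _ ()) (λ _ → refl)
not-≡-true {true}  = mk⇔ (λ ()) (λ ¬t → ⊥-elim (¬t tt))

pred[n]<n : ∀ {n} .⦃ _ : NonZero n ⦄ → pred n < n
pred[n]<n {suc n} = ≤-refl

halves-short : ∀ {A : Set} N .⦃ _ : NonZero N ⦄ (ys : List A) c zs →
               length ys ≡ pred N → length (ys ++ c ∷ zs) < 2 * N → length ys < N × length zs < N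
halves-short N ys c zs |ys|≡N-1 short =
  subst (_< N) (sym |ys|≡N-1) pred[n]<n ,
  +-cancelˡ-< N (length zs) N (begin-strict
    N + length zs                ≡⟨ cong (_+ length zs) (sym (trans (cong suc |ys|≡N-1) (suc-pred N))) ⟩
    suc (length ys) + length zs  ≡⟨ cong suc (sym (length-++ ys)) ⟩
    suc (length (ys ++ zs))      ≡⟨ sym (length-++-sucʳ ys c zs) ⟩
    length (ys ++ c ∷ zs)        <⟨ short ⟩
    2 * N                        ≡⟨ cong (N +_) (+-identityʳ N) ⟩
    N + N                        ∎)
  where open ≤-Reasoning

module _ {n t : ℕ} (χ : Fin n → Vec Bool t) where

  colours : List (Fin n) → BitSet t
  colours X = fromList (map χ X)

  ∈ₛ-colours⁺ : ∀ {x X} → x ∈ X → χ x ∈ₛ colours X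
  ∈ₛ-colours⁺ = ∈ₛ-fromList⁺ ∘ ∈-map⁺ χ

  ∈ₛ-colours⁻ : ∀ {v} X → v ∈ₛ colours X → Σ (Fin n) λ x → x ∈ X × v ≡ χ x
  ∈ₛ-colours⁻ X = ∈-map⁻ χ ∘ ∈ₛ-fromList⁻ (map χ X)

  colours-⊆ₛ : ∀ {X C} → All (λ x → χ x ∈ₛ C) X → colours X ⊆ₛ C
  colours-⊆ₛ {X} X⊆C v∈ with ∈ₛ-colours⁻ X v∈
  ... | x , x∈X , refl = All.lookup X⊆C x∈X

  colours-disjoint : ∀ {X Y} → All (λ x → All (λ y → χ x ≢ χ y) Y) X → Disjointₛ (colours X) (colours Y)
  colours-disjoint {X} {Y} apart v∈X v∈Y with ∈ₛ-colours⁻ X v∈X | ∈ₛ-colours⁻ Y v∈Y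
  ... | x , x∈X , refl | y , y∈Y , eq = All.lookup (All.lookup apart x∈X) y∈Y eq

  -- Side conditions under which walks from a coloured within C₁ and C₂ glue to a colourful walk within C.
  record JoinCondition (a : Fin n) (C C₁ C₂ : BitSet t) : Set where
    constructor joinable
    field
      disjoint : Disjointₛ C₁ C₂
      left⊆    : C₁ ⊆ₛ C
      right⊆   : C₂ ⊆ₛ C
      start∉   : ¬ χ a ∈ₛ C₂

  joinCondition? : ∀ a C C₁ C₂ → Dec (JoinCondition a C C₁ C₂)
  joinCondition? a C C₁ C₂ =
    map′ fromFields fields (disjointₛ? C₁ C₂ ×-dec C₁ ⊆ₛ? C ×-dec C₂ ⊆ₛ? C ×-dec ¬? (χ a ∈ₛ? C₂))
    where
    Fields = Disjointₛ C₁ C₂ × C₁ ⊆ₛ C × C₂ ⊆ₛ C × ¬ χ a ∈ₛ C₂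
    fromFields : Fields → JoinCondition a C C₁ C₂
    fromFields (d , l , r , s) = joinable d l r s
    fields : JoinCondition a C C₁ C₂ → Fields
    fields (joinable d l r s) = d , l , r , s

  colours-apart : ∀ {X Ys} → All (λ x → All (λ y → χ x ≢ χ y) (concat Ys)) X →
                  All (Disjointₛ (colours X)) (map colours Ys)
  colours-apart = All.map⁺ ∘ All.map colours-disjoint ∘ All.All-swap ∘ All.map All.concat⁻

  ∣colours∣ : ∀ {X} → AllPairs (_≢_ on χ) X → ∣ colours X ∣ₛ ≡ length X
  ∣colours∣ {X} distinct = trans (∣fromList∣ (AllPairs.map⁺ distinct)) (length-map χ X)

  disjoint-by-colours : ∀ {C C′ X Y} → Disjointₛ C C′ →
                        All (λ v → χ v ∈ₛ C) X → All (λ v → χ v ∈ₛ C′) Y → Disjoint X Y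
  disjoint-by-colours C#C′ X⊆C Y⊆C′ v v∈X v∈Y = C#C′ (All.lookup X⊆C v∈X) (All.lookup Y⊆C′ v∈Y)

  ∉ₛ-colours : ∀ {v Y} → All (λ y → v ≢ χ y) Y → ¬ v ∈ₛ colours Y
  ∉ₛ-colours {Y = Y} apart v∈Y with ∈ₛ-colours⁻ Y v∈Y
  ... | y , y∈Y , eq = All.lookup apart y∈Y eq

Edge : ∀ {n} → Graph n → Fin n → Fin n → Set
Edge G a b = adj G a b ≡ true

module _ {n t : ℕ} (G : Graph n) (S : Fin n → Bool) (χ : Fin n → Vec Bool t) where

  record ColourfulWalk (C : BitSet t) (a : Fin n) (vs : List (Fin n)) (b : Fin n) : Set where
    field
      linked    : Linked (Edge G) (a ∷ vs ++ [ b ])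
      avoidsS   : All (λ v → S v ≡ false) vs
      coloured  : All (λ v → χ v ∈ₛ C) (vs ++ [ b ])
      colourful : AllPairs (_≢_ on χ) (a ∷ vs ++ [ b ])

  open ColourfulWalk public

  edgeWalk : ∀ {C a b} → Edge G a b → χ b ∈ₛ C → χ a ≢ χ b → ColourfulWalk C a [] b
  edgeWalk e b∈C a≢b = record
    { linked = e ∷ [-] ; avoidsS = [] ; coloured = b∈C ∷ [] ; colourful = (a≢b ∷ []) ∷ [] ∷ [] }

  joinWalks : ∀ {C C₁ C₂ a vs₁ c vs₂ b} → ColourfulWalk C₁ a vs₁ c → S c ≡ false → ColourfulWalk C₂ c vs₂ b →
              JoinCondition χ a C C₁ C₂ → ColourfulWalk C a (vs₁ ++ c ∷ vs₂) b
  joinWalks {C} {C₁} {C₂} {a} {vs₁} {c} {vs₂} {b} w₁ c∉S w₂ (joinable C₁#C₂ C₁⊆C C₂⊆C a∉C₂) = record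
    { linked    = subst (Linked (Edge G) ∘ (a ∷_)) (sym (++-assoc vs₁ (c ∷ vs₂) [ b ]))
                    (Linked-glue a vs₁ c _ (linked w₁) (linked w₂))
    ; avoidsS   = All.++⁺ (avoidsS w₁) (c∉S ∷ avoidsS w₂)
    ; coloured  = subst (All _) (sym split) (All.++⁺ (All.map C₁⊆C (coloured w₁)) (All.map C₂⊆C (coloured w₂)))
    ; colourful = subst (AllPairs _ ∘ (a ∷_)) (sym split)
                    (All.++⁺ (AllPairs.head (colourful w₁)) a≢X₂
                     ∷ AllPairs.++⁺ (AllPairs.tail (colourful w₁)) (AllPairs.tail (colourful w₂)) X₁≢X₂)
    }
    where
    split = ++-[]-split vs₁ c vs₂ b
    a≢X₂ : All (λ y → χ a ≢ χ y) (vs₂ ++ [ b ])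
    a≢X₂ = All.map (λ y∈C₂ a≡y → a∉C₂ (subst (_∈ₛ C₂) (sym a≡y) y∈C₂)) (coloured w₂)
    X₁≢X₂ : All (λ x → All (λ y → χ x ≢ χ y) (vs₂ ++ [ b ])) (vs₁ ++ [ c ])
    X₁≢X₂ = All.map (λ x∈C₁ → All.map (λ y∈C₂ x≡y → C₁#C₂ x∈C₁ (subst (_∈ₛ C₂) (sym x≡y) y∈C₂)) (coloured w₂))
                    (coloured w₁)

  splitWalk : ∀ {C a b} vs₁ c vs₂ → ColourfulWalk C a (vs₁ ++ c ∷ vs₂) b →
              let C₁ = colours χ (vs₁ ++ [ c ]) ; C₂ = colours χ (vs₂ ++ [ b ]) in
              ColourfulWalk C₁ a vs₁ c × S c ≡ false × ColourfulWalk C₂ c vs₂ b × JoinCondition χ a C C₁ C₂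
  splitWalk {C} {a} {b} vs₁ c vs₂ w
    with linked₁ , linked₂ ← Linked-cut a vs₁ c (vs₂ ++ [ b ])
                               (subst (Linked (Edge G) ∘ (a ∷_)) (++-assoc vs₁ (c ∷ vs₂) [ b ]) (linked w))
    with coloured₁ , coloured₂ ← All.++⁻ (vs₁ ++ [ c ]) (subst (All _) (++-[]-split vs₁ c vs₂ b) (coloured w))
    with a≢X₁ ∷ distinct ← subst (AllPairs _ ∘ (a ∷_)) (++-[]-split vs₁ c vs₂ b) (colourful w)
    with distinct₁ , distinct₂ , X₁≢X₂ ← AllPairs-++⁻ (vs₁ ++ [ c ]) distinct
    with c∉S ∷ avoids₂ ← All.++⁻ʳ vs₁ (avoidsS w)
    = record { linked = linked₁ ; avoidsS = All.++⁻ˡ vs₁ (avoidsS w) ; coloured = All.tabulate (∈ₛ-colours⁺ χ)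
             ; colourful = All.++⁻ˡ (vs₁ ++ [ c ]) a≢X₁ ∷ distinct₁ } ,
      c∉S ,
      record { linked = linked₂ ; avoidsS = avoids₂ ; coloured = All.tabulate (∈ₛ-colours⁺ χ)
             ; colourful = All.lookup X₁≢X₂ (∈-++⁺ʳ vs₁ (here refl)) ∷ distinct₂ } ,
      joinable (colours-disjoint χ X₁≢X₂) (colours-⊆ₛ χ coloured₁) (colours-⊆ₛ χ coloured₂)
               (∉ₛ-colours χ (All.++⁻ʳ (vs₁ ++ [ c ]) a≢X₁))

module _ {n t : ℕ} {G : Graph n} {S : Fin n → Bool} {χ : Fin n → Vec Bool t} {r : ℕ} {u : Fin n} where

  toBPath : ∀ {C vs b} → ColourfulWalk G S χ C u vs b → S b ≡ true → ∣ C ∣ₛ ≤ r → BPath r G S u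
  toBPath {C} {vs} {b} w b∈S |C|≤r = record
    { inner    = vs
    ; end      = b
    ; walk     = linked w
    ; simple   = AllPairs.map (λ χx≢χy → χx≢χy ∘ cong χ) (colourful w)
    ; short    = ≤-trans (≤-reflexive (sym length-vs++b)) (≤-trans pigeonhole |C|≤r)
    ; endInS   = b∈S
    ; innerOut = avoidsS w
    }
    where
    length-vs++b : length (map χ (vs ++ [ b ])) ≡ suc (length vs)
    length-vs++b = trans (length-map χ (vs ++ [ b ])) (length-++-[] vs b)
    pigeonhole : length (map χ (vs ++ [ b ])) ≤ ∣ C ∣ₛ
    pigeonhole = length≤∣∣ₛ (AllPairs.map⁺ (AllPairs.tail (colourful w))) (All.map⁺ (coloured w))

  fromBPath : (p : BPath r G S u) → AllPairs (_≢_ on χ) (u ∷ nonRoot p) →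
              ColourfulWalk G S χ (colours χ (nonRoot p)) u (inner p) (end p)
  fromBPath p distinct = record
    { linked = walk p ; avoidsS = innerOut p ; coloured = All.tabulate (∈ₛ-colours⁺ χ) ; colourful = distinct }

module _ {n r : ℕ} {G : Graph n} {S : Fin n → Bool} {u : Fin n} where

  nonRoots : List (BPath r G S u) → List (Fin n)
  nonRoots ps = concat (map nonRoot ps)

  length-nonRoots : ∀ ps → length (nonRoots ps) ≤ length ps * r
  length-nonRoots []       = z≤n
  length-nonRoots (p ∷ ps) = begin
    length (nonRoot p ++ nonRoots ps)        ≡⟨ length-++ (nonRoot p) ⟩
    length (nonRoot p) + length (nonRoots ps) ≤⟨ +-mono-≤ (≤-trans (≤-reflexive (length-++-[] (inner p) (end p))) (short p))
                                                          (length-nonRoots ps) ⟩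
    r + length ps * r                         ∎
    where open ≤-Reasoning

  family-unique : ∀ {ps} → IsFamily ps → Unique (u ∷ nonRoots ps)
  family-unique {ps} fam =
    All.concat⁺ (heads ps) ∷ AllPairs.concat⁺ (tails ps) (AllPairs.map⁺ (AllPairs.map disjoint⇒≢ fam))
    where
    heads : ∀ ps → All (All (u ≢_)) (map nonRoot ps)
    heads []       = []
    heads (p ∷ ps) = AllPairs.head (simple p) ∷ heads ps
    tails : ∀ ps → All Unique (map nonRoot ps)
    tails []       = []
    tails (p ∷ ps) = AllPairs.tail (simple p) ∷ tails ps
    disjoint⇒≢ : ∀ {X Y : List (Fin n)} → Disjoint X Y → All (λ x → All (x ≢_) Y) X
    disjoint⇒≢ {Y = Y} X#Y =
      All.tabulate λ x∈X → All.tabulate λ y∈Y x≡y → X#Y _ x∈X (subst (_∈ Y) (sym x≡y) y∈Y)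

enumBitSet : ∀ t → Enumeration (BitSet t)
enumBitSet zero = record
  { elements = leaf true ∷ leaf false ∷ []
  ; complete = λ { (leaf true) → here refl ; (leaf false) → there (here refl) }
  }
enumBitSet (suc t) = record
  { elements = cartesianProductWith node (elements (enumBitSet t)) (elements (enumBitSet t))
  ; complete = λ { (node A B) →
      ∈-cartesianProductWith⁺ node (complete (enumBitSet t) A) (complete (enumBitSet t) B) }
  }

-- Enough hash positions to colour u and k paths with at most r further vertices each.
hashLength : ℕ → ℕ → ℕ
hashLength r k = suc (k * r) * suc (k * r)

module BconnCircuit (n r k : ℕ) where

  t : ℕ
  t = hashLength r k

  V Positions Colours : Set
  V         = Fin n
  Positions = Vec (Fin (suc ⌊log₂ n ⌋)) t
  Colours   = BitSet t

  χ : Positions → V → Vec Bool t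
  χ = colouring

  _≢?_ : ∀ (c c′ : Vec Bool t) → Dec (c ≢ c′)
  c ≢? c′ = ¬? (Vec.≡-dec Bool._≟_ c c′)

  I : Set
  I = Input n

  edgeIn : V → V → I
  edgeIn a b = inj₁ (a , b)

  inS isRoot : V → I
  inS v    = inj₂ (inj₁ v)
  isRoot v = inj₂ (inj₂ v)

  eV : Enumeration V
  eV = enumFin n

  eP : Enumeration Positions
  eP = enumVec (enumFin _) t

  eC : Enumeration Colours
  eC = enumBitSet t

  notSSpec : V → GateSpec I ⊥
  notSSpec v = NOT′ (inj₁ (inS v))

  notS : Layered I V
  notS = extend noGates eV notSSpec

  WalkIndex : Set
  WalkIndex = Positions × Colours × V × V

  eW : Enumeration WalkIndex
  eW = eP ×ₑ eC ×ₑ eV ×ₑ eV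

  SplitChoice : Set
  SplitChoice = Maybe (V × Colours × Colours)

  eSplit : Enumeration SplitChoice
  eSplit = enumMaybe (eV ×ₑ eC ×ₑ eC)

  edge? : ∀ P C a b → Dec (χ P b ∈ₛ C × χ P a ≢ χ P b)
  edge? P C a b = (χ P b ∈ₛ? C) ×-dec (χ P a ≢? χ P b)

  lastEdge? : ∀ P C a c C₁ b → Dec (JoinCondition (χ P) a C C₁ (colours (χ P) [ b ]) × χ P c ≢ χ P b)
  lastEdge? P C a c C₁ b = joinCondition? (χ P) a C C₁ (colours (χ P) [ b ]) ×-dec (χ P c ≢? χ P b)

  edgeSpec : WalkIndex → GateSpec I V
  edgeSpec (P , C , a , b) = guard (edge? P C a b) (AND′ (inj₁ (edgeIn a b) ∷ inj₂ b ∷ []))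

  splitSpec : WalkIndex × SplitChoice → GateSpec I WalkIndex
  splitSpec (w , nothing) = AND′ [ inj₂ w ]
  splitSpec ((P , C , a , b) , just (c , C₁ , C₂)) =
    guard (joinCondition? (χ P) a C C₁ C₂) (AND′ (inj₂ (P , C₁ , a , c) ∷ inj₂ (P , C₂ , c , b) ∷ []))

  someSplit : WalkIndex → GateSpec I (WalkIndex × SplitChoice)
  someSplit w = anyOf eSplit (w ,_)

  -- Layer j detects colourful walks with fewer than 2 ^ j inner vertices, ending outside S.
  walks : ℕ → Layered I WalkIndex
  walks zero    = extend notS eW edgeSpec
  walks (suc j) = extend (extend (walks j) (eW ×ₑ eSplit) splitSpec) eW someSplit

  PathChoice : Set
  PathChoice = V × V × Maybe (V × Colours)

  ePath : Enumeration PathChoice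
  ePath = eV ×ₑ eV ×ₑ enumMaybe (eV ×ₑ eC)

  directInputs : V → V → List (I ⊎ WalkIndex)
  directInputs a b = inj₁ (isRoot a) ∷ inj₁ (inS b) ∷ inj₁ (edgeIn a b) ∷ []

  viaInputs : Positions → Colours → V → V → V → List (I ⊎ WalkIndex)
  viaInputs P C₁ a c b = inj₁ (isRoot a) ∷ inj₁ (inS b) ∷ inj₁ (edgeIn c b) ∷ inj₂ (P , C₁ , a , c) ∷ []

  -- Walk layers only reach vertices outside S, so a path into S ends with a separate last edge.
  pathSpec : (Positions × Colours) × PathChoice → GateSpec I WalkIndex
  pathSpec ((P , C) , a , b , nothing)       = guard (edge? P C a b) (AND′ (directInputs a b))
  pathSpec ((P , C) , a , b , just (c , C₁)) = guard (lastEdge? P C a c C₁ b) (AND′ (viaInputs P C₁ a c b))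

  lastSteps : Layered I ((Positions × Colours) × PathChoice)
  lastSteps = extend (walks ⌈log₂ r ⌉) ((eP ×ₑ eC) ×ₑ ePath) pathSpec

  somePath : Positions × Colours → GateSpec I ((Positions × Colours) × PathChoice)
  somePath i = anyOf ePath (i ,_)

  paths : Layered I (Positions × Colours)
  paths = extend lastSteps (eP ×ₑ eC) somePath

  Admissible : List Colours → Set
  Admissible Cs = AllPairs Disjointₛ Cs × All (λ C → ∣ C ∣ₛ ≤ r) Cs

  admissible? : ∀ Cs → Dec (Admissible Cs)
  admissible? Cs = allPairs? disjointₛ? Cs ×-dec all? (λ C → ∣ C ∣ₛ ≤? r) Cs

  TupleIndex : Set
  TupleIndex = Positions × Vec Colours k

  eT : Enumeration TupleIndex
  eT = eP ×ₑ enumVec eC k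

  tupleSpec : TupleIndex → GateSpec I (Positions × Colours)
  tupleSpec (P , Cs) = guard (admissible? (toList Cs)) (allOf (toList Cs) (P ,_))

  tuples : Layered I TupleIndex
  tuples = extend paths eT tupleSpec

  someTupleSpec : ⊤ → GateSpec I TupleIndex
  someTupleSpec _ = anyOf eT id

  someTuple : Layered I ⊤
  someTuple = extend tuples enum⊤ someTupleSpec

  negation : ⊤ → GateSpec I ⊤
  negation _ = NOT′ (inj₂ tt)

  noTuple : Layered I ⊤
  noTuple = extend someTuple enum⊤ negation

  circuit : Circuit I
  circuit = record { nGates = width noTuple ; gates = gates noTuple ; output = out noTuple tt }

module Correctness (n r k : ℕ) (G : Graph n) (S : Fin n → Bool) (u : Fin n) where

  open BconnCircuit n r k

  x : I → Bool
  x = encode G S u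

  T-isRoot : ∀ {v} → T (x (isRoot v)) → v ≡ u
  T-isRoot = toWitness

  T-notS : ∀ {v} → T (value notS x v) ⇔ S v ≡ false
  T-notS = mk⇔ (to T-not-≡ ∘ extend⁻ noGates eV notSSpec) (extend⁺ noGates eV notSSpec ∘ from T-not-≡)

  record Reach (j : ℕ) (P : Positions) (C : Colours) (a b : V) : Set where
    constructor reach
    field fires : T (value (walks j) x (P , C , a , b))

  EdgeStep : Positions → Colours → V → V → Set
  EdgeStep P C a b = (χ P b ∈ₛ C × χ P a ≢ χ P b) × Edge G a b × S b ≡ false

  reach-zero : ∀ {P C a b} → Reach 0 P C a b ⇔ EdgeStep P C a b
  reach-zero {P} {C} {a} {b} = mk⇔ elim intro
    where
    inputs = inj₁ (edgeIn a b) ∷ inj₂ b ∷ []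
    elim : Reach 0 P C a b → EdgeStep P C a b
    elim (reach h) with cond , gs ← guard⁻ (edge? P C a b) (extend⁻ notS eW edgeSpec h)
           with e ∷ b∉S ∷ [] ← AND′⁻ x (value notS x) inputs gs
           = cond , to T-≡ e , to T-notS b∉S
    intro : EdgeStep P C a b → Reach 0 P C a b
    intro (cond , e , b∉S) = reach (extend⁺ notS eW edgeSpec
      (guard⁺ (edge? P C a b) cond (AND′⁺ x (value notS x) inputs (from T-≡ e ∷ from T-notS b∉S ∷ []))))

  ReachStep : ℕ → Positions → Colours → V → V → Set
  ReachStep j P C a b = Reach j P C a b ⊎ ∃ λ ((c , C₁ , C₂) : V × Colours × Colours) →
                          JoinCondition (χ P) a C C₁ C₂ × Reach j P C₁ a c × Reach j P C₂ c b

  reach-suc : ∀ {j P C a b} → Reach (suc j) P C a b ⇔ ReachStep j P C a b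
  reach-suc {j} {P} {C} {a} {b} = mk⇔ elim intro
    where
    w = P , C , a , b
    W = value (walks j) x
    splits = extend (walks j) (eW ×ₑ eSplit) splitSpec
    Split : SplitChoice → Set
    Split o = T (value splits x (w , o))
    split⁻ : ∀ {o} → Split o → T (evalSpec x W (splitSpec (w , o)))
    split⁻ = extend⁻ (walks j) (eW ×ₑ eSplit) splitSpec
    split⁺ : ∀ {o} → T (evalSpec x W (splitSpec (w , o))) → Split o
    split⁺ = extend⁺ (walks j) (eW ×ₑ eSplit) splitSpec
    halves : V → Colours → Colours → List (I ⊎ WalkIndex)
    halves c C₁ C₂ = inj₂ (P , C₁ , a , c) ∷ inj₂ (P , C₂ , c , b) ∷ []

    bySplit : ∀ o → Split o → ReachStep j P C a b
    bySplit nothing s with r ∷ [] ← AND′⁻ x W [ inj₂ w ] (split⁻ s) = inj₁ (reach r)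
    bySplit (just (c , C₁ , C₂)) s
      with fits , gs ← guard⁻ (joinCondition? (χ P) a C C₁ C₂) (split⁻ s)
      with r₁ ∷ r₂ ∷ [] ← AND′⁻ x W (halves c C₁ C₂) gs
      = inj₂ ((c , C₁ , C₂) , fits , reach r₁ , reach r₂)

    elim : Reach (suc j) P C a b → ReachStep j P C a b
    elim (reach h) =
      let o , s = anyOf⁻ x (value splits x) eSplit (w ,_) (extend⁻ splits eW someSplit h) in bySplit o s

    via : ∀ o → Split o → Reach (suc j) P C a b
    via o s = reach (extend⁺ splits eW someSplit (anyOf⁺ x (value splits x) eSplit (w ,_) o s))

    intro : ReachStep j P C a b → Reach (suc j) P C a b
    intro (inj₁ (reach r)) = via nothing (split⁺ (AND′⁺ x W [ inj₂ w ] (r ∷ [])))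
    intro (inj₂ ((c , C₁ , C₂) , fits , reach r₁ , reach r₂)) = via (just (c , C₁ , C₂))
      (split⁺ (guard⁺ (joinCondition? (χ P) a C C₁ C₂) fits (AND′⁺ x W (halves c C₁ C₂) (r₁ ∷ r₂ ∷ []))))

  WalkOutsideS : Positions → Colours → V → V → Set
  WalkOutsideS P C a b = ∃ λ vs → ColourfulWalk G S (χ P) C a vs b × S b ≡ false

  reach-sound : ∀ j {P C a b} → Reach j P C a b → WalkOutsideS P C a b
  reach-sound zero {P} r
    with (b∈C , a≢b) , e , b∉S ← to reach-zero r
    = [] , edgeWalk G S (χ P) e b∈C a≢b , b∉S
  reach-sound (suc j) {P} r with to reach-suc r
  ... | inj₁ r′ = reach-sound j r′
  ... | inj₂ (_ , fits , r₁ , r₂)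
    with vs₁ , w₁ , c∉S ← reach-sound j r₁
    with vs₂ , w₂ , b∉S ← reach-sound j r₂
    = _ , joinWalks G S (χ P) w₁ c∉S w₂ fits , b∉S

  reach-complete : ∀ j {P C a vs b} → ColourfulWalk G S (χ P) C a vs b → S b ≡ false →
                   length vs < 2 ^ j → Reach j P C a b
  reach-complete zero {vs = []} w b∉S _
    with e ∷ [-] ← linked w | b∈C ∷ [] ← coloured w | (a≢b ∷ []) ∷ _ ← colourful w
    = from reach-zero ((b∈C , a≢b) , e , b∉S)
  reach-complete zero {vs = _ ∷ _} _ _ (s≤s ())
  reach-complete (suc j) {P} {vs = vs} w b∉S short with length vs <? 2 ^ j
  ... | yes shorter = from reach-suc (inj₁ (reach-complete j w b∉S shorter))
  ... | no longer
    with vs₁ , c , vs₂ , refl , |vs₁|≡N-1 ← splitAt vs {pred (2 ^ j)}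
                                              (<-≤-trans (pred[n]<n {2 ^ j} ⦃ m^n≢0 2 j ⦄) (≮⇒≥ longer))
    with short₁ , short₂ ← halves-short (2 ^ j) ⦃ m^n≢0 2 j ⦄ vs₁ c vs₂ |vs₁|≡N-1 short
    with w₁ , c∉S , w₂ , fits ← splitWalk G S (χ P) vs₁ c vs₂ w
    = from reach-suc (inj₂ (_ , fits , reach-complete j w₁ c∉S short₁ ,
                                       reach-complete j w₂ b∉S short₂))

  J : ℕ
  J = ⌈log₂ r ⌉

  u-isRoot : T (x (isRoot u))
  u-isRoot = fromWitness refl

  W : WalkIndex → Bool
  W = value (walks J) x

  paths⁺ : ∀ {P C} o → T (evalSpec x W (pathSpec ((P , C) , o))) → T (value paths x (P , C))
  paths⁺ {P} {C} o g = extend⁺ lastSteps (eP ×ₑ eC) somePath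
    (anyOf⁺ x (value lastSteps x) ePath ((P , C) ,_) o (extend⁺ (walks J) ((eP ×ₑ eC) ×ₑ ePath) pathSpec g))

  ColourfulPath : Positions → Colours → Set
  ColourfulPath P C = ∃ λ ((vs , b) : List V × V) → ColourfulWalk G S (χ P) C u vs b × S b ≡ true

  paths-sound : ∀ P C → T (value paths x (P , C)) → ColourfulPath P C
  paths-sound P C h
    with (a , b , o) , s ← anyOf⁻ x (value lastSteps x) ePath ((P , C) ,_)
                             (extend⁻ lastSteps (eP ×ₑ eC) somePath h)
    = byChoice o (extend⁻ (walks J) ((eP ×ₑ eC) ×ₑ ePath) pathSpec s)
    where
    byChoice : ∀ o → T (evalSpec x W (pathSpec ((P , C) , a , b , o))) → ColourfulPath P C
    byChoice nothing g
      with (b∈C , a≢b) , gs ← guard⁻ (edge? P C a b) g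
      with ra ∷ sb ∷ e ∷ [] ← AND′⁻ x W (directInputs a b) gs
      with refl ← T-isRoot ra
      = ([] , b) , edgeWalk G S (χ P) (to T-≡ e) b∈C a≢b , to T-≡ sb
    byChoice (just (c , C₁)) g
      with (fits , c≢b) , gs ← guard⁻ (lastEdge? P C a c C₁ b) g
      with ra ∷ sb ∷ e ∷ fires₁ ∷ [] ← AND′⁻ x W (viaInputs P C₁ a c b) gs
      with refl ← T-isRoot ra
      with vs , w₁ , c∉S ← reach-sound J (reach fires₁)
      = (vs ++ [ c ] , b) ,
        joinWalks G S (χ P) w₁ c∉S (edgeWalk G S (χ P) (to T-≡ e) (∈ₛ-colours⁺ (χ P) {X = [ b ]} (here refl)) c≢b)
                  fits ,
        to T-≡ sb

  paths-complete : ∀ P C {vs b} → ColourfulWalk G S (χ P) C u vs b → S b ≡ true → suc (length vs) ≤ r →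
                   T (value paths x (P , C))
  paths-complete P C {vs} {b} w b∈S short with initLast vs
  ... | []
    with e ∷ [-] ← linked w | b∈C ∷ [] ← coloured w | (u≢b ∷ []) ∷ _ ← colourful w
    = paths⁺ (u , b , nothing)
        (guard⁺ (edge? P C u b) (b∈C , u≢b)
          (AND′⁺ x W (directInputs u b) (u-isRoot ∷ from T-≡ b∈S ∷ from T-≡ e ∷ [])))
  ... | vs₁ ∷ʳ′ c
    with w₁ , c∉S , w₂ , fits ← splitWalk G S (χ P) vs₁ c [] w
    with e ∷ [-] ← linked w₂ | (c≢b ∷ []) ∷ _ ← colourful w₂
    = paths⁺ (u , b , just (c , C₁)) (guard⁺ (lastEdge? P C u c C₁ b) (fits , c≢b)
        (AND′⁺ x W (viaInputs P C₁ u c b)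
          (u-isRoot ∷ from T-≡ b∈S ∷ from T-≡ e ∷ Reach.fires (reach-complete J w₁ c∉S short₁) ∷ [])))
    where
    C₁ = colours (χ P) (vs₁ ++ [ c ])
    short₁ : length vs₁ < 2 ^ J
    short₁ = begin-strict
      length vs₁                 <⟨ n<1+n _ ⟩
      suc (length vs₁)           ≡⟨ sym (length-++-[] vs₁ c) ⟩
      length (vs₁ ++ [ c ])      <⟨ short ⟩
      r                          ≤⟨ n≤2^⌈log₂n⌉ r ⟩
      2 ^ J                      ∎
      where open ≤-Reasoning

  tuples⁻ : ∀ P Cs → T (value tuples x (P , Cs)) →
            Admissible (toList Cs) × All (λ C → T (value paths x (P , C))) (toList Cs)
  tuples⁻ P Cs h =
    let adm , gs = guard⁻ (admissible? (toList Cs)) (extend⁻ paths eT tupleSpec h)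
    in adm , allOf⁻ x (value paths x) (toList Cs) (P ,_) gs

  tuples⁺ : ∀ P Cs → Admissible (toList Cs) → All (λ C → T (value paths x (P , C))) (toList Cs) →
            T (value tuples x (P , Cs))
  tuples⁺ P Cs adm fires = extend⁺ paths eT tupleSpec
    (guard⁺ (admissible? (toList Cs)) adm (allOf⁺ x (value paths x) (toList Cs) (P ,_) fires))

  Family : Set
  Family = List (BPath r G S u)

  family : ∀ P (Cs : List Colours) → Admissible Cs → All (λ C → T (value paths x (P , C))) Cs →
           Σ Family λ ps → IsFamily ps × length ps ≡ length Cs ×
                           All (λ p → Any (λ C → All (λ v → χ P v ∈ₛ C) (nonRoot p)) Cs) ps
  family P []       _                                 []          = [] , [] , refl , []
  family P (C ∷ Cs) (C#Cs ∷ disjoint , |C|≤r ∷ small) (fires ∷ firesCs) =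
    let (vs , b) , w , b∈S = paths-sound P C fires
        ps , fam , len , within = family P Cs (disjoint , small) firesCs
    in toBPath w b∈S |C|≤r ∷ ps , separated C#Cs (coloured w) within ∷ fam , cong suc len ,
       here (coloured w) ∷ All.map there within
    where
    separated : ∀ {C Cs X} {ps : Family} → All (Disjointₛ C) Cs → All (λ v → χ P v ∈ₛ C) X →
                All (λ q → Any (λ C′ → All (λ v → χ P v ∈ₛ C′) (nonRoot q)) Cs) ps →
                All (λ q → Disjoint X (nonRoot q)) ps
    separated C#Cs X⊆C = All.map λ inCs →
      let C′ , C′∈Cs , q⊆C′ = find inCs in disjoint-by-colours (χ P) (All.lookup C#Cs C′∈Cs) X⊆C q⊆C′

  colourSets : ∀ P (ps : Family) → AllPairs (_≢_ on χ P) (u ∷ nonRoots ps) →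
               let Cs = map (colours (χ P)) (map nonRoot ps) in
               Admissible Cs × All (λ C → T (value paths x (P , C))) Cs
  colourSets P []       _ = ([] , []) , []
  colourSets P (p ∷ ps) (u≢ ∷ distinct)
    with dp , drest , cross ← AllPairs-++⁻ (nonRoot p) distinct
    with (disjoint , small) , fires ← colourSets P ps (All.++⁻ʳ (nonRoot p) u≢ ∷ drest)
    = (colours-apart (χ P) cross ∷ disjoint ,
       ≤-trans (≤-reflexive (trans (∣colours∣ (χ P) dp) (length-++-[] (inner p) (end p)))) (short p) ∷ small) ,
      paths-complete P _ (fromBPath p (All.++⁻ˡ (nonRoot p) u≢ ∷ dp)) (endInS p) (short p) ∷ fires

  someTuple⁻ : T (value someTuple x tt) → Σ Family λ ps → IsFamily ps × length ps ≡ k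
  someTuple⁻ h =
    let (P , Cs) , fires = anyOf⁻ x (value tuples x) eT id (extend⁻ tuples enum⊤ someTupleSpec h)
        adm , firesCs = tuples⁻ P Cs fires
        ps , fam , len , _ = family P (toList Cs) adm firesCs
    in ps , fam , trans len (Vec.length-toList Cs)

  someTuple⁺ : ∀ (ps : Family) → IsFamily ps → length ps ≡ k → T (value someTuple x tt)
  someTuple⁺ ps fam |ps|≡k = extend⁺ tuples enum⊤ someTupleSpec (anyOf⁺ x (value tuples x) eT id (P , Cs)
    (tuples⁺ P Cs (subst Admissible (sym toList-Cs) (proj₁ sets)) (subst (All _) (sym toList-Cs) (proj₂ sets))))
    where
    X = u ∷ nonRoots ps
    |X|≤s : length X ≤ suc (k * r)
    |X|≤s = s≤s (subst (λ m → length (nonRoots ps) ≤ m * r) |ps|≡k (length-nonRoots ps))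
    hashed = hashing (<⇒≤ (n<2^suc⌊log₂n⌋ n)) t X (family-unique fam) (*-mono-≤ |X|≤s |X|≤s)
    P = proj₁ hashed
    sets = colourSets P ps (proj₂ hashed)
    Cs-list = map (colours (χ P)) (map nonRoot ps)
    |Cs|≡k : length Cs-list ≡ k
    |Cs|≡k = trans (length-map _ (map nonRoot ps)) (trans (length-map nonRoot ps) |ps|≡k)
    Cs = Vec.cast |Cs|≡k (Vec.fromList Cs-list)
    toList-Cs : toList Cs ≡ Cs-list
    toList-Cs = trans (Vec.toList-cast |Cs|≡k (Vec.fromList Cs-list)) (Vec.toList∘fromList Cs-list)

  eval-circuit : eval circuit x ≡ not (value someTuple x tt)
  eval-circuit = extend-value someTuple enum⊤ negation x tt

  ¬someTuple⇔bconn<k : (¬ T (value someTuple x tt)) ⇔ BconnLt r G S u k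
  ¬someTuple⇔bconn<k = mk⇔ sound adequate
    where
    sound : ¬ T (value someTuple x tt) → BconnLt r G S u k
    sound ¬fires ps fam with k ≤? length ps
    ... | no k≰|ps| = ≰⇒> k≰|ps|
    ... | yes k≤|ps| = ⊥-elim (¬fires (someTuple⁺ (take k ps) (AllPairs.take⁺ k fam)
                                         (trans (length-take k ps) (m≤n⇒m⊓n≡m k≤|ps|))))
    adequate : BconnLt r G S u k → ¬ T (value someTuple x tt)
    adequate fewer fires = let ps , fam , |ps|≡k = someTuple⁻ fires in
      n≮n k (subst (_< k) |ps|≡k (fewer ps fam))

  circuit-correct : eval circuit x ≡ true ⇔ BconnLt r G S u k
  circuit-correct = mk⇔
    (to ¬someTuple⇔bconn<k ∘ to not-≡-true ∘ trans (sym eval-circuit))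
    (trans eval-circuit ∘ from not-≡-true ∘ from ¬someTuple⇔bconn<k)

^-distribʳ-* : ∀ a b e → (a * b) ^ e ≡ a ^ e * b ^ e
^-distribʳ-* a b zero    = refl
^-distribʳ-* a b (suc e) = trans (cong ((a * b) *_) (^-distribʳ-* a b e)) (swap a b (a ^ e) (b ^ e))
  where
  swap : ∀ a b x y → (a * b) * (x * y) ≡ (a * x) * (b * y)
  swap = solve-∀

1+n≤2^n : ∀ n → suc n ≤ 2 ^ n
1+n≤2^n zero    = s≤s z≤n
1+n≤2^n (suc n) = begin
  2 + n           ≤⟨ +-mono-≤ (m^n>0 2 n) (1+n≤2^n n) ⟩
  2 ^ n + 2 ^ n   ≡⟨ cong (2 ^ n +_) (sym (+-identityʳ (2 ^ n))) ⟩
  2 * 2 ^ n       ∎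
  where open ≤-Reasoning

-- Writing x = q t + (x mod t) gives x ≤ (q + 1) t and (q + 1) ^ t ≤ 2 ^ (q t) ≤ 2 ^ x.
x^t≤t^t*2^x : ∀ x t → x ^ t ≤ t ^ t * 2 ^ x
x^t≤t^t*2^x x zero         = ≤-trans (m^n>0 2 x) (≤-reflexive (sym (+-identityʳ (2 ^ x))))
x^t≤t^t*2^x x t@(suc _) = begin
  x ^ t                 ≤⟨ ^-monoˡ-≤ t x≤[q+1]t ⟩
  (suc q * t) ^ t       ≡⟨ ^-distribʳ-* (suc q) t t ⟩
  suc q ^ t * t ^ t     ≤⟨ *-monoˡ-≤ (t ^ t) (^-monoˡ-≤ t (1+n≤2^n q)) ⟩
  (2 ^ q) ^ t * t ^ t   ≡⟨ cong (_* t ^ t) (^-*-assoc 2 q t) ⟩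
  2 ^ (q * t) * t ^ t   ≤⟨ *-monoˡ-≤ (t ^ t) (^-monoʳ-≤ 2 qt≤x) ⟩
  2 ^ x * t ^ t         ≡⟨ *-comm (2 ^ x) (t ^ t) ⟩
  t ^ t * 2 ^ x         ∎
  where
  open ≤-Reasoning
  q = x / t
  x≤[q+1]t : x ≤ suc q * t
  x≤[q+1]t = ≤-trans (≤-reflexive (m≡m%n+[m/n]*n x t)) (+-monoˡ-≤ (q * t) (<⇒≤ (m%n<n x t)))
  qt≤x : q * t ≤ x
  qt≤x = ≤-trans (m≤n+m (q * t) (x % t)) (≤-reflexive (sym (m≡m%n+[m/n]*n x t)))

-- Every index set of the construction has at most (levelFactor r k · (n + 1)) ^ 8 elements.
levelFactor : ℕ → ℕ → ℕ
levelFactor r k = t ^ t * 2 * suc ∣ enumBitSet t ∣ₑ ^ k * suc ∣ enumBitSet t ∣ₑ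
  where t = hashLength r k

sizeFactor : ℕ → ℕ → ℕ
sizeFactor r k = (2 * ⌈log₂ r ⌉ + 7) * levelFactor r k ^ 8

module Bounds (n r k : ℕ) where

  open BconnCircuit n r k

  J : ℕ
  J = ⌈log₂ r ⌉

  walks-depth : ∀ j w → depthOf (walks j) w ≤ 2 * suc j
  walks-depth zero    = extend-depth notS eW edgeSpec 1 (extend-depth noGates eV notSSpec 0 λ ())
  walks-depth (suc j) w = ≤-trans
    (extend-depth _ eW someSplit _ (extend-depth (walks j) (eW ×ₑ eSplit) splitSpec _ (walks-depth j)) w)
    (≤-reflexive (sym (*-suc 2 (suc j))))

  circuit-depth : depth circuit ≤ 8 * suc J
  circuit-depth = begin
    depthOf noTuple tt      ≤⟨ extend-depth someTuple enum⊤ negation _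
                                (extend-depth tuples enum⊤ someTupleSpec _
                                  (extend-depth paths eT tupleSpec _
                                    (extend-depth lastSteps (eP ×ₑ eC) somePath _
                                      (extend-depth (walks J) ((eP ×ₑ eC) ×ₑ ePath) pathSpec _ (walks-depth J))))) tt ⟩
    5 + 2 * suc J           ≤⟨ m≤m+n (5 + 2 * suc J) (1 + 6 * J) ⟩
    5 + 2 * suc J + (1 + 6 * J) ≡⟨ arith J ⟩
    8 * suc J               ∎
    where
    open ≤-Reasoning
    arith : ∀ J → 5 + 2 * suc J + (1 + 6 * J) ≡ 8 * suc J
    arith = solve-∀

  private
    m Y R Z : ℕ
    m = suc n
    Y = suc ∣ eC ∣ₑ
    R = levelFactor r k
    Z = R * m

    T₀ : ℕ
    T₀ = t ^ t * 2

    1≤T₀ : 1 ≤ T₀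
    1≤T₀ = *-mono-≤ (m^n>0 t t) (s≤s (z≤n {1}))

    2≤R : 2 ≤ R
    2≤R = *-mono-≤ (*-mono-≤ (*-mono-≤ (m^n>0 t t) (≤-refl {2})) (m^n>0 Y k)) (s≤s (z≤n {∣ eC ∣ₑ}))

    T₀≤R : T₀ ≤ R
    T₀≤R = ≤-trans (m≤m*n T₀ (Y ^ k) ⦃ m^n≢0 Y k ⦄) (m≤m*n _ Y)

    Y^k≤R : Y ^ k ≤ R
    Y^k≤R = ≤-trans (m≤n*m (Y ^ k) T₀ ⦃ >-nonZero 1≤T₀ ⦄) (m≤m*n _ Y)

    Y≤R : Y ≤ R
    Y≤R = m≤n*m Y (T₀ * Y ^ k) ⦃ >-nonZero (*-mono-≤ 1≤T₀ (m^n>0 Y k)) ⦄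

    2≤Z : 2 ≤ Z
    2≤Z = *-mono-≤ 2≤R (s≤s (z≤n {n}))

    instance
      Z≢0 : NonZero Z
      Z≢0 = >-nonZero (≤-trans (s≤s z≤n) 2≤Z)

    record _≤Z^_ {A : Set} (E : Enumeration A) (i : ℕ) : Set where
      constructor bounded
      field bound : ∣ E ∣ₑ ≤ Z ^ i
    open _≤Z^_

    ≤Z^-mono : ∀ {A : Set} {E : Enumeration A} {i j} → E ≤Z^ i → i ≤ j → E ≤Z^ j
    ≤Z^-mono (bounded E≤) i≤j = bounded (≤-trans E≤ (^-monoʳ-≤ Z i≤j))

    ≤R⇒≤Z¹ : ∀ {a} → a ≤ R → a ≤ Z ^ 1
    ≤R⇒≤Z¹ a≤R = ≤-trans a≤R (≤-trans (≤-reflexive (sym (*-identityʳ R))) (≤-trans (*-monoʳ-≤ R (s≤s z≤n))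
                   (≤-reflexive (sym (*-identityʳ Z)))))

    ×ₑ-≤Z^ : ∀ {A B : Set} {EA : Enumeration A} {EB : Enumeration B} {i j} →
             EA ≤Z^ i → EB ≤Z^ j → (EA ×ₑ EB) ≤Z^ (i + j)
    ×ₑ-≤Z^ {EA = EA} {EB} {i} {j} (bounded A≤) (bounded B≤) = bounded (begin
      ∣ EA ×ₑ EB ∣ₑ       ≡⟨ ∣×ₑ∣ EA EB ⟩
      ∣ EA ∣ₑ * ∣ EB ∣ₑ    ≤⟨ *-mono-≤ A≤ B≤ ⟩
      Z ^ i * Z ^ j       ≡⟨ sym (^-distribˡ-+-* Z i j) ⟩
      Z ^ (i + j)         ∎)
      where open ≤-Reasoning

    enumMaybe-≤Z^ : ∀ {A : Set} {EA : Enumeration A} {i} → EA ≤Z^ i → enumMaybe EA ≤Z^ suc i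
    enumMaybe-≤Z^ {EA = EA} {i} (bounded A≤) = bounded (begin
      ∣ enumMaybe EA ∣ₑ    ≡⟨ ∣enumMaybe∣ EA ⟩
      1 + ∣ EA ∣ₑ          ≤⟨ +-mono-≤ (m^n>0 Z i) A≤ ⟩
      Z ^ i + Z ^ i        ≡⟨ cong (Z ^ i +_) (sym (+-identityʳ (Z ^ i))) ⟩
      2 * Z ^ i            ≤⟨ *-monoˡ-≤ (Z ^ i) 2≤Z ⟩
      Z ^ suc i            ∎)
      where open ≤-Reasoning

    eV-≤Z : eV ≤Z^ 1
    eV-≤Z = bounded (≤-trans (≤-reflexive (∣enumFin∣ n)) (≤-trans (n≤1+n n)
              (≤-trans (m≤n*m m R ⦃ >-nonZero (≤-trans (s≤s z≤n) 2≤R) ⦄) (≤-reflexive (sym (*-identityʳ Z))))))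

    eC-≤Z : eC ≤Z^ 1
    eC-≤Z = bounded (≤R⇒≤Z¹ (≤-trans (n≤1+n _) Y≤R))

    eCs-≤Z : enumVec eC k ≤Z^ 1
    eCs-≤Z = bounded (≤R⇒≤Z¹ (begin
      ∣ enumVec eC k ∣ₑ    ≡⟨ ∣enumVec∣ eC k ⟩
      ∣ eC ∣ₑ ^ k          ≤⟨ ^-monoˡ-≤ k (n≤1+n _) ⟩
      Y ^ k                ≤⟨ Y^k≤R ⟩
      R                    ∎))
      where open ≤-Reasoning

    eP-≤Z : eP ≤Z^ 1
    eP-≤Z = bounded (≤-trans (begin
      ∣ eP ∣ₑ                      ≡⟨ ∣enumVec∣ (enumFin _) t ⟩
      ∣ enumFin L ∣ₑ ^ t           ≡⟨ cong (_^ t) (∣enumFin∣ L) ⟩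
      L ^ t                        ≤⟨ x^t≤t^t*2^x L t ⟩
      t ^ t * 2 ^ L                ≤⟨ *-monoʳ-≤ (t ^ t) (2^suc⌊log₂n⌋≤2[1+n] n) ⟩
      t ^ t * (2 * m)              ≡⟨ sym (*-assoc (t ^ t) 2 m) ⟩
      T₀ * m                       ≤⟨ *-monoˡ-≤ m T₀≤R ⟩
      Z                            ∎) (≤-reflexive (sym (*-identityʳ Z))))
      where
      open ≤-Reasoning
      L = suc ⌊log₂ n ⌋

    B : ℕ
    B = Z ^ 8

    eW-≤Z : eW ≤Z^ 4
    eW-≤Z = ×ₑ-≤Z^ eP-≤Z (×ₑ-≤Z^ eC-≤Z (×ₑ-≤Z^ eV-≤Z eV-≤Z))

    ∣eW∣≤ : ∣ eW ∣ₑ ≤ B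
    ∣eW∣≤ = bound (≤Z^-mono eW-≤Z (m≤m+n 4 4))

    ∣eW×eSplit∣≤ : ∣ eW ×ₑ eSplit ∣ₑ ≤ B
    ∣eW×eSplit∣≤ = bound (×ₑ-≤Z^ eW-≤Z (enumMaybe-≤Z^ (×ₑ-≤Z^ eV-≤Z (×ₑ-≤Z^ eC-≤Z eC-≤Z))))

    ∣eP×eC∣≤ : ∣ eP ×ₑ eC ∣ₑ ≤ B
    ∣eP×eC∣≤ = bound (≤Z^-mono (×ₑ-≤Z^ eP-≤Z eC-≤Z) (m≤m+n 2 6))

    ∣lastSteps∣≤ : ∣ (eP ×ₑ eC) ×ₑ ePath ∣ₑ ≤ B
    ∣lastSteps∣≤ = bound (≤Z^-mono (×ₑ-≤Z^ (×ₑ-≤Z^ eP-≤Z eC-≤Z) (×ₑ-≤Z^ eV-≤Z (×ₑ-≤Z^ eV-≤Z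
                     (enumMaybe-≤Z^ (×ₑ-≤Z^ eV-≤Z eC-≤Z))))) (n≤1+n 7))

    ∣eT∣≤ : ∣ eT ∣ₑ ≤ B
    ∣eT∣≤ = bound (≤Z^-mono (×ₑ-≤Z^ eP-≤Z eCs-≤Z) (m≤m+n 2 6))

    1≤B : 1 ≤ B
    1≤B = m^n>0 Z 8

  walks-width : ∀ j → width (walks j) ≤ 2 * suc j * B
  walks-width zero    = ≤-trans (+-mono-≤ ∣eW∣≤ (+-monoˡ-≤ 0 (bound (≤Z^-mono {j = 8} eV-≤Z (s≤s z≤n)))))
                                (≤-reflexive (double B))
    where
    double : ∀ B → B + (B + 0) ≡ 2 * 1 * B
    double = solve-∀
  walks-width (suc j) = ≤-trans (+-mono-≤ ∣eW∣≤ (+-mono-≤ ∣eW×eSplit∣≤ (walks-width j)))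
                                (≤-reflexive (two-more j B))
    where
    two-more : ∀ j B → B + (B + 2 * suc j * B) ≡ 2 * suc (suc j) * B
    two-more = solve-∀

  circuit-size : size circuit ≤ sizeFactor r k * suc n ^ 8
  circuit-size = begin
    width noTuple                                ≤⟨ +-mono-≤ 1≤B (+-mono-≤ 1≤B (+-mono-≤ ∣eT∣≤ (+-mono-≤ ∣eP×eC∣≤
                                                      (+-mono-≤ ∣lastSteps∣≤ (walks-width J))))) ⟩
    B + (B + (B + (B + (B + 2 * suc J * B))))    ≡⟨ five-more J B ⟩
    (2 * J + 7) * B                              ≡⟨ cong ((2 * J + 7) *_) (^-distribʳ-* R m 8) ⟩
    (2 * J + 7) * (R ^ 8 * m ^ 8)                ≡⟨ sym (*-assoc (2 * J + 7) (R ^ 8) (m ^ 8)) ⟩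
    sizeFactor r k * suc n ^ 8                   ∎
    where
    open ≤-Reasoning
    five-more : ∀ J B → B + (B + (B + (B + (B + 2 * suc J * B)))) ≡ (2 * J + 7) * B
    five-more = solve-∀

lemma20 : Σ ((n r k : ℕ) → Circuit (Input n)) λ A →
          Σ (ℕ → ℕ → ℕ) λ f →
          Σ ℕ λ c →
          ∀ n r k →
            (depth (A n r k) ≤ c * suc ⌈log₂ r ⌉)
            × (size (A n r k) ≤ f r k * suc n ^ c)
            × (∀ (G : Graph n) (S : Fin n → Bool) (u : Fin n) → S u ≡ true →
                 (eval (A n r k) (encode G S u) ≡ true ⇔ BconnLt r G S u k))
lemma20 = (λ n r k → BconnCircuit.circuit n r k) , sizeFactor , 8 , λ n r k →
  Bounds.circuit-depth n r k , Bounds.circuit-size n r k , λ G S u _ → Correctness.circuit-correct n r k G S u
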